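{- The translation $I$ from the language of $\mathrm{CTT}^\omega$ to the language of $\mathrm{STT}^{\uparrow}$, which preserves all logical vocabulary (connectives, quantifiers with their types, and same-type identity) and sends each atomic formula $y^n(x^m)$ (with $m<n$) to $y^n(\uparrow^{\,n-1-m}x^m)$ (the result of applying $n-1-m$ instances of $\uparrow$ to $x^m$), is an interpretation: every theorem of $\mathrm{CTT}^\omega$ is translated into a theorem of $\mathrm{STT}^\uparrow$.
   Context: $\mathrm{CTT}^\omega$: cumulative type theory with types $n<\omega$; atomic formulas $y^n(x^m)$ well-formed iff $m<n$, and $a^n=b^n$ (same type); classical natural deduction with usual identity rules at each type; quantifier rules: for $m\le n$, from $\forall x^n\phi(x^n)$ infer $\phi(a^m)$, and from $\phi(b^n)$ infer $\forall x^m\phi(x^m)$ (all expressions well-formed, $b^n$ not in undischarged assumptions); dually for $\exists$. Comprehension: $\exists z^{n+1}\forall x^n(z^{n+1}(x^n)\leftrightarrow\phi(x^n))$ for well-formed $\phi$ not containing $z^{n+1}$. Defined ($k=\max(m,n)+1$): $a^m\equiv b^n:\Leftrightarrow\forall x^k(x^k(a^m)\leftrightarrow x^k(b^n))$, $a^m\,\hat\in\,b^n:\Leftrightarrow\exists x^k(x^k\equiv b^n\wedge x^k(a^m))$. Axioms: Type-Founded $\forall a^m\forall b^{n+1}(a^m\,\hat\in\,b^{n+1}\to\exists x^n\,a^m\equiv x^n)$; Type-Base $\forall x^0\forall y^m\neg(y^m\,\hat\in\,x^0)$. $\mathrm{STT}$: types $n<\omega$; $b^n(a^m)$ well-formed iff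 $n=m+1$; identity only between same-type terms; quantifier rules only instantiate/generalise at the same type; Comprehension $\exists z^{n+1}\forall x^n(z^{n+1}(x^n)\leftrightarrow\phi(x^n))$ ($\phi$ not containing $z^{n+1}$); identity scheme $x^n=y^n\leftrightarrow\forall z^{n+1}(z^{n+1}(x^n)\leftrightarrow z^{n+1}(y^n))$. $\mathrm{STT}^\uparrow$ adds, for each $n$, a function symbol $\uparrow$ taking type-$n$ terms to type-$(n+1)$ terms, extends Comprehension to formulas containing $\uparrow$, and adds axioms: Up-Inject $\forall x^n\forall y^n(\uparrow x^n=\uparrow y^n\to x^n=y^n)$; Up-Possess $\forall x^n\forall y^{n+1}(\uparrow y^{n+1}(\uparrow x^n)\leftrightarrow y^{n+1}(x^n))$; Up-Founded $\forall x^{n+1}\forall y^{n+1}(\uparrow y^{n+1}(x^{n+1})\to\exists z^n\,x^{n+1}=\uparrow z^n)$; Up-Base $\forall x^0\forall y^0\neg\uparrow y^0(x^0)$. -}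

module Defs where

-- Formulas use a locally-nameless representation:
-- free variables are  fv n i  (the i-th variable of type n), bound
-- variables are de Bruijn indices  bv k  (k = 0 is the innermost binder);
-- each quantifier carries the type of the variable it binds.

open import Data.Nat using (ℕ; zero; suc; _≤_; _<_; _⊔_; _∸_; _≡ᵇ_)
open import Data.Bool using (if_then_else_)
open import Data.Maybe using (Maybe; just; nothing; fromMaybe) renaming (map to mapMaybe)
open import Data.List using (List; []; _∷_)
open import Data.List.Membership.Propositional using (_∈_)
open import Data.List.Relation.Unary.All using (All)
open import Data.Product using (_×_)
open import Data.Empty using (⊥)
open import Data.Sum using (_⊎_)
open import Relation.Nullary using (¬_)
open import Relation.Binary.PropositionalEquality using (_≡_)

infixr 4 _⇒_ _⇔_
infixr 5 _∨'_
infixr 6 _∧'_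
infix 7 _≐_

data Form (T : Set) : Set where
  atom : T → T → Form T          -- atom y x  is  y(x)
  _≐_  : T → T → Form T
  ⊥'   : Form T
  _⇒_ _∧'_ _∨'_ : Form T → Form T → Form T
  ∀' ∃' : ℕ → Form T → Form T

¬'_ : ∀ {T} → Form T → Form T
¬' φ = φ ⇒ ⊥'

_⇔_ : ∀ {T} → Form T → Form T → Form T
φ ⇔ ψ = (φ ⇒ ψ) ∧' (ψ ⇒ φ)

lookupM : List ℕ → ℕ → Maybe ℕ
lookupM []      _       = nothing
lookupM (n ∷ Δ) zero    = just n
lookupM (n ∷ Δ) (suc k) = lookupM Δ k

record Lang : Set₁ where
  field
    Tm     : Set
    var    : ℕ → ℕ → Tm
    tyT    : List ℕ → Tm → Maybe ℕ   -- type of a term, given the types of bound variables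
    openT  : ℕ → Tm → Tm → Tm        -- openT d u t : replace bound index d by u in t
    OccT   : ℕ → ℕ → Tm → Set
    AtomOK : ℕ → ℕ → Set             -- AtomOK n m : y^n(x^m) is well formed
    InstOK : ℕ → ℕ → Set             -- InstOK m n : quantifier over type n may be
                                     -- instantiated / generalised at type m

module _ (L : Lang) where
  open Lang L

  data WF (Δ : List ℕ) : Form Tm → Set where
    wf-atom : ∀ {y x n m} → tyT Δ y ≡ just n → tyT Δ x ≡ just m → AtomOK n m →
              WF Δ (atom y x)
    wf-eq   : ∀ {a b n} → tyT Δ a ≡ just n → tyT Δ b ≡ just n → WF Δ (a ≐ b)
    wf-⊥    : WF Δ ⊥'
    wf-⇒    : ∀ {φ ψ} → WF Δ φ → WF Δ ψ → WF Δ (φ ⇒ ψ)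
    wf-∧    : ∀ {φ ψ} → WF Δ φ → WF Δ ψ → WF Δ (φ ∧' ψ)
    wf-∨    : ∀ {φ ψ} → WF Δ φ → WF Δ ψ → WF Δ (φ ∨' ψ)
    wf-∀    : ∀ {n φ} → WF (n ∷ Δ) φ → WF Δ (∀' n φ)
    wf-∃    : ∀ {n φ} → WF (n ∷ Δ) φ → WF Δ (∃' n φ)

  -- well-formed (and locally closed) formula
  WF₀ : Form Tm → Set
  WF₀ = WF []

  openAt : ℕ → Tm → Form Tm → Form Tm
  openAt d u (atom y x) = atom (openT d u y) (openT d u x)
  openAt d u (a ≐ b)    = openT d u a ≐ openT d u b
  openAt d u ⊥'         = ⊥'
  openAt d u (φ ⇒ ψ)    = openAt d u φ ⇒ openAt d u ψ
  openAt d u (φ ∧' ψ)   = openAt d u φ ∧' openAt d u ψ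
  openAt d u (φ ∨' ψ)   = openAt d u φ ∨' openAt d u ψ
  openAt d u (∀' n φ)   = ∀' n (openAt (suc d) u φ)
  openAt d u (∃' n φ)   = ∃' n (openAt (suc d) u φ)

  _[_] : Form Tm → Tm → Form Tm
  φ [ u ] = openAt 0 u φ

  OccF : ℕ → ℕ → Form Tm → Set
  OccF n i (atom y x) = OccT n i y ⊎ OccT n i x
  OccF n i (a ≐ b)    = OccT n i a ⊎ OccT n i b
  OccF n i ⊥'         = ⊥
  OccF n i (φ ⇒ ψ)    = OccF n i φ ⊎ OccF n i ψ
  OccF n i (φ ∧' ψ)   = OccF n i φ ⊎ OccF n i ψ
  OccF n i (φ ∨' ψ)   = OccF n i φ ⊎ OccF n i ψ
  OccF n i (∀' _ φ)   = OccF n i φ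
  OccF n i (∃' _ φ)   = OccF n i φ

  FreshIn : ℕ → ℕ → List (Form Tm) → Set
  FreshIn n i Γ = All (λ φ → ¬ OccF n i φ) Γ

  -- Classical natural deduction (in sequent form) with identity rules,
  -- over a set of axioms Ax.  Every formula occurring is well formed.
  data Pf (Ax : Form Tm → Set) (Γ : List (Form Tm)) : Form Tm → Set where
    hyp  : ∀ {φ} → φ ∈ Γ → WF₀ φ → Pf Ax Γ φ
    ax   : ∀ {φ} → Ax φ → WF₀ φ → Pf Ax Γ φ
    ⇒I   : ∀ {φ ψ} → WF₀ φ → Pf Ax (φ ∷ Γ) ψ → Pf Ax Γ (φ ⇒ ψ)
    ⇒E   : ∀ {φ ψ} → Pf Ax Γ (φ ⇒ ψ) → Pf Ax Γ φ → Pf Ax Γ ψ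
    ∧I   : ∀ {φ ψ} → Pf Ax Γ φ → Pf Ax Γ ψ → Pf Ax Γ (φ ∧' ψ)
    ∧E₁  : ∀ {φ ψ} → Pf Ax Γ (φ ∧' ψ) → Pf Ax Γ φ
    ∧E₂  : ∀ {φ ψ} → Pf Ax Γ (φ ∧' ψ) → Pf Ax Γ ψ
    ∨I₁  : ∀ {φ ψ} → WF₀ ψ → Pf Ax Γ φ → Pf Ax Γ (φ ∨' ψ)
    ∨I₂  : ∀ {φ ψ} → WF₀ φ → Pf Ax Γ ψ → Pf Ax Γ (φ ∨' ψ)
    ∨E   : ∀ {φ ψ χ} → Pf Ax Γ (φ ∨' ψ) → Pf Ax (φ ∷ Γ) χ → Pf Ax (ψ ∷ Γ) χ →
           Pf Ax Γ χ
    ⊥E   : ∀ {φ} → WF₀ φ → Pf Ax Γ ⊥' → Pf Ax Γ φ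
    raa  : ∀ {φ} → WF₀ φ → Pf Ax ((¬' φ) ∷ Γ) ⊥' → Pf Ax Γ φ
    ∀E   : ∀ {n m φ} (a : Tm) → tyT [] a ≡ just m → InstOK m n → WF₀ (φ [ a ]) →
           Pf Ax Γ (∀' n φ) → Pf Ax Γ (φ [ a ])
    ∀I   : ∀ {n m φ} (b : ℕ) → InstOK m n → FreshIn n b Γ → ¬ OccF n b φ →
           WF₀ (∀' m φ) → Pf Ax Γ (φ [ var n b ]) → Pf Ax Γ (∀' m φ)
    ∃I   : ∀ {n m φ} (a : Tm) → tyT [] a ≡ just m → InstOK m n → WF₀ (∃' n φ) →
           Pf Ax Γ (φ [ a ]) → Pf Ax Γ (∃' n φ)
    ∃E   : ∀ {n m φ ψ} (b : ℕ) → InstOK m n → FreshIn n b Γ → ¬ OccF n b φ →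
           ¬ OccF n b ψ → WF₀ (φ [ var n b ]) →
           Pf Ax Γ (∃' m φ) → Pf Ax ((φ [ var n b ]) ∷ Γ) ψ → Pf Ax Γ ψ
    =I   : ∀ {n} (a : Tm) → tyT [] a ≡ just n → Pf Ax Γ (a ≐ a)
    =E   : ∀ {a b} (φ : Form Tm) → WF₀ (φ [ b ]) →
           Pf Ax Γ (a ≐ b) → Pf Ax Γ (φ [ a ]) → Pf Ax Γ (φ [ b ])

  Thm : (Form Tm → Set) → Form Tm → Set
  Thm Ax φ = Pf Ax [] φ

data TmC : Set where
  fv : ℕ → ℕ → TmC
  bv : ℕ → TmC

tyC : List ℕ → TmC → Maybe ℕ
tyC Δ (fv n i) = just n
tyC Δ (bv k)   = lookupM Δ k

openC : ℕ → TmC → TmC → TmC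
openC d u (fv n i) = fv n i
openC d u (bv k)   = if k ≡ᵇ d then u else bv k

OccC : ℕ → ℕ → TmC → Set
OccC n i (fv n' i') = n ≡ n' × i ≡ i'
OccC n i (bv k)     = ⊥

CTTω : Lang
CTTω = record
  { Tm = TmC ; var = fv ; tyT = tyC ; openT = openC ; OccT = OccC
  ; AtomOK = λ n m → m < n
  ; InstOK = λ m n → m ≤ n
  }

shC : TmC → TmC
shC (fv n i) = fv n i
shC (bv k)   = bv (suc k)

equivC : ℕ → ℕ → TmC → TmC → Form TmC
equivC m n a b = ∀' (suc (m ⊔ n)) (atom (bv 0) (shC a) ⇔ atom (bv 0) (shC b))

memC : ℕ → ℕ → TmC → TmC → Form TmC
memC m n a b = ∃' (suc (m ⊔ n))
  (equivC (suc (m ⊔ n)) n (bv 0) (shC b) ∧' atom (bv 0) (shC a))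

data AxCTT : Form TmC → Set where
  -- ∃z^{n+1} ∀x^n (z^{n+1}(x^n) ↔ φ(x^n)),  φ well formed, not containing z
  comprehension : ∀ n (φ : Form TmC) → WF CTTω (n ∷ []) φ →
    AxCTT (∃' (suc n) (∀' n (atom (bv 1) (bv 0) ⇔ φ)))
  typeFounded : ∀ m n →
    AxCTT (∀' m (∀' (suc n) (memC m (suc n) (bv 1) (bv 0) ⇒
                             ∃' n (equivC m n (bv 2) (bv 0)))))
  typeBase : ∀ m →
    AxCTT (∀' 0 (∀' m (¬' memC m 0 (bv 0) (bv 1))))

data TmS : Set where
  fv : ℕ → ℕ → TmS
  bv : ℕ → TmS
  up : TmS → TmS

tyS : List ℕ → TmS → Maybe ℕ
tyS Δ (fv n i) = just n
tyS Δ (bv k)   = lookupM Δ k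
tyS Δ (up t)   = mapMaybe suc (tyS Δ t)

openS : ℕ → TmS → TmS → TmS
openS d u (fv n i) = fv n i
openS d u (bv k)   = if k ≡ᵇ d then u else bv k
openS d u (up t)   = up (openS d u t)

OccS : ℕ → ℕ → TmS → Set
OccS n i (fv n' i') = n ≡ n' × i ≡ i'
OccS n i (bv k)     = ⊥
OccS n i (up t)     = OccS n i t

STT↑ : Lang
STT↑ = record
  { Tm = TmS ; var = fv ; tyT = tyS ; openT = openS ; OccT = OccS
  ; AtomOK = λ n m → n ≡ suc m
  ; InstOK = λ m n → m ≡ n
  }

data AxSTT↑ : Form TmS → Set where
  comprehension : ∀ n (φ : Form TmS) → WF STT↑ (n ∷ []) φ →
    AxSTT↑ (∃' (suc n) (∀' n (atom (bv 1) (bv 0) ⇔ φ)))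
  identity : ∀ n →
    AxSTT↑ (∀' n (∀' n ((bv 1 ≐ bv 0) ⇔
                        ∀' (suc n) (atom (bv 0) (bv 2) ⇔ atom (bv 0) (bv 1)))))
  upInject : ∀ n →
    AxSTT↑ (∀' n (∀' n ((up (bv 1) ≐ up (bv 0)) ⇒ (bv 1 ≐ bv 0))))
  upPossess : ∀ n →
    AxSTT↑ (∀' n (∀' (suc n) (atom (up (bv 0)) (up (bv 1)) ⇔ atom (bv 0) (bv 1))))
  upFounded : ∀ n →
    AxSTT↑ (∀' (suc n) (∀' (suc n) (atom (up (bv 0)) (bv 1) ⇒
                                    ∃' n (bv 2 ≐ up (bv 0)))))
  upBase :
    AxSTT↑ (∀' 0 (∀' 0 (¬' atom (up (bv 0)) (bv 1))))

trT : TmC → TmS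
trT (fv n i) = fv n i
trT (bv k)   = bv k

ups : ℕ → TmS → TmS
ups zero    t = t
ups (suc k) t = up (ups k t)

-- type of a CTT term (defaulting to 0 for ill-formed input)
tyCD : List ℕ → TmC → ℕ
tyCD Δ t = fromMaybe 0 (tyC Δ t)

-- I Δ φ, where Δ lists the types of the bound variables in scope
I : List ℕ → Form TmC → Form TmS
I Δ (atom y x) = atom (trT y) (ups (tyCD Δ y ∸ 1 ∸ tyCD Δ x) (trT x))
I Δ (a ≐ b)    = trT a ≐ trT b
I Δ ⊥'         = ⊥'
I Δ (φ ⇒ ψ)    = I Δ φ ⇒ I Δ ψ
I Δ (φ ∧' ψ)   = I Δ φ ∧' I Δ ψ
I Δ (φ ∨' ψ)   = I Δ φ ∨' I Δ ψ
I Δ (∀' n φ)   = ∀' n (I (n ∷ Δ) φ)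
I Δ (∃' n φ)   = ∃' n (I (n ∷ Δ) φ)

{-# OPTIONS --safe #-}
module Submission where

-- I commutes with the connectives, so the propositional and identity rules of CTTω translate to
-- the same rules of STT↑.  The work lies in the cumulative quantifier rules, which instantiate a
-- quantifier over type n at a variable a of a lower type m.  In STT↑ one instantiates at ↑^(n-m) a
-- instead, and the result is equivalent to the translation of the CTTω instance: an atom y(↑^i a)
-- is literally unchanged, and an atom a(↑^i x) becomes ↑^(n-m) a (↑^(n-m+i) x), which is
-- equivalent to it by iterated Up-Possess.  Generalisation and ∃-elimination at a lower type
-- reduce to this instantiation.  Comprehension translates to Comprehension; the defined ≡ and ∈̂
-- translate to Leibniz identity and membership up to ↑, so Type-Base and Type-Founded follow
-- from the identity scheme together with iterated Up-Base and Up-Founded.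

open import Defs
open import Data.List using (List; []; _∷_; map; length; _++_)
open import Data.List.Membership.Propositional.Properties using (∈-map⁺)
open import Data.List.Relation.Unary.Any using (here; there)
open import Data.List.Relation.Unary.All using ([]; _∷_)
open import Data.Nat using (ℕ; zero; suc; _+_; _∸_; _≤_; _<_; _⊔_; _≡ᵇ_; z≤n; s≤s)
open import Data.Nat.Properties
open import Data.Bool using (true; false; if_then_else_)
open import Data.Maybe using (just; fromMaybe) renaming (map to mapMaybe)
open import Data.Product using (∃-syntax; _×_; _,_; proj₁; proj₂)
open import Data.Sum using (inj₁; inj₂)
open import Data.Empty using (⊥-elim)
open import Function using (const; _∘_; case_of_)
open import Relation.Nullary using (¬_; yes; no)
open import Relation.Nullary.Decidable using (dec-true; dec-false)
open import Relation.Binary.PropositionalEquality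

derivable⇒WF : ∀ {L Ax Γ φ} → Pf L Ax Γ φ → WF₀ L φ
derivable⇒WF (hyp _ w) = w
derivable⇒WF (ax _ w) = w
derivable⇒WF (⇒I w p) = wf-⇒ w (derivable⇒WF p)
derivable⇒WF (⇒E p _) with derivable⇒WF p
... | wf-⇒ _ w = w
derivable⇒WF (∧I p q) = wf-∧ (derivable⇒WF p) (derivable⇒WF q)
derivable⇒WF (∧E₁ p) with derivable⇒WF p
... | wf-∧ w _ = w
derivable⇒WF (∧E₂ p) with derivable⇒WF p
... | wf-∧ _ w = w
derivable⇒WF (∨I₁ w p) = wf-∨ (derivable⇒WF p) w
derivable⇒WF (∨I₂ w p) = wf-∨ w (derivable⇒WF p)
derivable⇒WF (∨E _ q _) = derivable⇒WF q
derivable⇒WF (⊥E w _) = w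
derivable⇒WF (raa w _) = w
derivable⇒WF (∀E _ _ _ w _) = w
derivable⇒WF (∀I _ _ _ _ w _) = w
derivable⇒WF (∃I _ _ _ w _) = w
derivable⇒WF (∃E _ _ _ _ _ _ _ q) = derivable⇒WF q
derivable⇒WF (=I _ e) = wf-eq e e
derivable⇒WF (=E _ w _ _) = w

infix 3 _⊢_
_⊢_ : List (Form TmS) → Form TmS → Set
_⊢_ = Pf STT↑ AxSTT↑

WF↑ : List ℕ → Form TmS → Set
WF↑ = WF STT↑

WF↑₀ : Form TmS → Set
WF↑₀ = WF₀ STT↑

open↑ : ℕ → TmS → Form TmS → Form TmS
open↑ = openAt STT↑

openᶜ : ℕ → TmC → Form TmC → Form TmC
openᶜ = openAt CTTω

≡ᵇ-refl : ∀ k → (k ≡ᵇ k) ≡ true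
≡ᵇ-refl k = dec-true (k ≟ k) refl

≢⇒≡ᵇ-false : ∀ {k d} → ¬ k ≡ d → (k ≡ᵇ d) ≡ false
≢⇒≡ᵇ-false {k} {d} = dec-false (k ≟ d)

openS-bv-hit : ∀ d u → openS d u (bv d) ≡ u
openS-bv-hit d u rewrite ≡ᵇ-refl d = refl

openS-bv-miss : ∀ {d k} u → ¬ k ≡ d → openS d u (bv k) ≡ bv k
openS-bv-miss u k≢d rewrite ≢⇒≡ᵇ-false k≢d = refl

data Closed : TmS → Set where
  fv : ∀ {n i} → Closed (fv n i)
  up : ∀ {t} → Closed t → Closed (up t)

openS-closed : ∀ {t} → Closed t → ∀ d u → openS d u t ≡ t
openS-closed fv d u = refl
openS-closed (up c) d u = cong up (openS-closed c d u)

tyS-closed : ∀ {t} → Closed t → ∀ Δ → tyS Δ t ≡ tyS [] t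
tyS-closed fv Δ = refl
tyS-closed (up c) Δ = cong (mapMaybe suc) (tyS-closed c Δ)

ups-closed : ∀ k {t} → Closed t → Closed (ups k t)
ups-closed zero c = c
ups-closed (suc k) c = up (ups-closed k c)

tyS-ups : ∀ k Δ t {r} → tyS Δ t ≡ just r → tyS Δ (ups k t) ≡ just (k + r)
tyS-ups zero Δ t e = e
tyS-ups (suc k) Δ t e rewrite tyS-ups k Δ t e = refl

openS-ups : ∀ k d u t → openS d u (ups k t) ≡ ups k (openS d u t)
openS-ups zero d u t = refl
openS-ups (suc k) d u t = cong up (openS-ups k d u t)

ups-+ : ∀ a b t → ups a (ups b t) ≡ ups (a + b) t
ups-+ zero b t = refl
ups-+ (suc a) b t = cong up (ups-+ a b t)

openS-ups-hit : ∀ k d u → openS d u (ups k (bv d)) ≡ ups k u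
openS-ups-hit k d u = trans (openS-ups k d u (bv d)) (cong (ups k) (openS-bv-hit d u))

openS-comm : ∀ i j {u v} → Closed u → Closed v → ¬ i ≡ j → ∀ t →
             openS i u (openS j v t) ≡ openS j v (openS i u t)
openS-comm i j cu cv i≢j (fv n l) = refl
openS-comm i j cu cv i≢j (up t) = cong up (openS-comm i j cu cv i≢j t)
openS-comm i j {u} {v} cu cv i≢j (bv k) with k ≟ j | k ≟ i
... | yes refl | yes refl = ⊥-elim (i≢j refl)
... | yes refl | no k≢i
  rewrite openS-bv-hit k v | openS-bv-miss u k≢i | openS-bv-hit k v = openS-closed cv i u
... | no k≢j | yes refl
  rewrite openS-bv-miss v k≢j | openS-bv-hit k u = sym (openS-closed cu j v)
... | no k≢j | no k≢i
  rewrite openS-bv-miss v k≢j | openS-bv-miss u k≢i | openS-bv-miss v k≢j = refl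

open↑-comm : ∀ i j {u v} → Closed u → Closed v → ¬ i ≡ j → ∀ φ →
             open↑ i u (open↑ j v φ) ≡ open↑ j v (open↑ i u φ)
open↑-comm i j cu cv i≢j (atom y x) = cong₂ atom (openS-comm i j cu cv i≢j y) (openS-comm i j cu cv i≢j x)
open↑-comm i j cu cv i≢j (a ≐ b) = cong₂ _≐_ (openS-comm i j cu cv i≢j a) (openS-comm i j cu cv i≢j b)
open↑-comm i j cu cv i≢j ⊥' = refl
open↑-comm i j cu cv i≢j (φ ⇒ ψ) = cong₂ _⇒_ (open↑-comm i j cu cv i≢j φ) (open↑-comm i j cu cv i≢j ψ)
open↑-comm i j cu cv i≢j (φ ∧' ψ) = cong₂ _∧'_ (open↑-comm i j cu cv i≢j φ) (open↑-comm i j cu cv i≢j ψ)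
open↑-comm i j cu cv i≢j (φ ∨' ψ) = cong₂ _∨'_ (open↑-comm i j cu cv i≢j φ) (open↑-comm i j cu cv i≢j ψ)
open↑-comm i j cu cv i≢j (∀' n φ) = cong (∀' n) (open↑-comm (suc i) (suc j) cu cv (i≢j ∘ suc-injective) φ)
open↑-comm i j cu cv i≢j (∃' n φ) = cong (∃' n) (open↑-comm (suc i) (suc j) cu cv (i≢j ∘ suc-injective) φ)

lookupM-bounded : ∀ Δ k {r} → lookupM Δ k ≡ just r → k < length Δ
lookupM-bounded (q ∷ Δ) zero e = s≤s z≤n
lookupM-bounded (q ∷ Δ) (suc k) e = s≤s (lookupM-bounded Δ k e)

lookupM-++ : ∀ Δ Δ' k {r} → lookupM Δ k ≡ just r → lookupM (Δ ++ Δ') k ≡ just r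
lookupM-++ (q ∷ Δ) Δ' zero e = e
lookupM-++ (q ∷ Δ) Δ' (suc k) e = lookupM-++ Δ Δ' k e

tyS-open-bv : ∀ Δ p {u} k → tyS [] u ≡ just p → Closed u →
              tyS Δ (openS (length Δ) u (bv k)) ≡ lookupM (Δ ++ p ∷ []) k
tyS-open-bv [] p zero e cu = e
tyS-open-bv [] p (suc k) e cu = refl
tyS-open-bv (q ∷ Δ) p zero e cu = refl
tyS-open-bv (q ∷ Δ) p {u} (suc k) e cu with k ≡ᵇ length Δ | tyS-open-bv Δ p k e cu
... | true | r = trans (tyS-closed cu (q ∷ Δ)) (trans (sym (tyS-closed cu Δ)) r)
... | false | r = r

tyS-open : ∀ Δ p {u} t → tyS [] u ≡ just p → Closed u →
           tyS Δ (openS (length Δ) u t) ≡ tyS (Δ ++ p ∷ []) t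
tyS-open Δ p (fv n i) e cu = refl
tyS-open Δ p (bv k) e cu = tyS-open-bv Δ p k e cu
tyS-open Δ p (up t) e cu = cong (mapMaybe suc) (tyS-open Δ p t e cu)

WF-open : ∀ Δ p {u} φ → tyS [] u ≡ just p → Closed u →
          WF↑ (Δ ++ p ∷ []) φ → WF↑ Δ (open↑ (length Δ) u φ)
WF-open Δ p (atom y x) e cu (wf-atom e₁ e₂ ok) =
  wf-atom (trans (tyS-open Δ p y e cu) e₁) (trans (tyS-open Δ p x e cu) e₂) ok
WF-open Δ p (a ≐ b) e cu (wf-eq e₁ e₂) =
  wf-eq (trans (tyS-open Δ p a e cu) e₁) (trans (tyS-open Δ p b e cu) e₂)
WF-open Δ p ⊥' e cu wf-⊥ = wf-⊥
WF-open Δ p (φ ⇒ ψ) e cu (wf-⇒ w₁ w₂) = wf-⇒ (WF-open Δ p φ e cu w₁) (WF-open Δ p ψ e cu w₂)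
WF-open Δ p (φ ∧' ψ) e cu (wf-∧ w₁ w₂) = wf-∧ (WF-open Δ p φ e cu w₁) (WF-open Δ p ψ e cu w₂)
WF-open Δ p (φ ∨' ψ) e cu (wf-∨ w₁ w₂) = wf-∨ (WF-open Δ p φ e cu w₁) (WF-open Δ p ψ e cu w₂)
WF-open Δ p (∀' n φ) e cu (wf-∀ w) = wf-∀ (WF-open (n ∷ Δ) p φ e cu w)
WF-open Δ p (∃' n φ) e cu (wf-∃ w) = wf-∃ (WF-open (n ∷ Δ) p φ e cu w)

WF-close : ∀ Δ p {u} φ → tyS [] u ≡ just p → Closed u →
           WF↑ Δ (open↑ (length Δ) u φ) → WF↑ (Δ ++ p ∷ []) φ
WF-close Δ p (atom y x) e cu (wf-atom e₁ e₂ ok) =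
  wf-atom (trans (sym (tyS-open Δ p y e cu)) e₁) (trans (sym (tyS-open Δ p x e cu)) e₂) ok
WF-close Δ p (a ≐ b) e cu (wf-eq e₁ e₂) =
  wf-eq (trans (sym (tyS-open Δ p a e cu)) e₁) (trans (sym (tyS-open Δ p b e cu)) e₂)
WF-close Δ p ⊥' e cu wf-⊥ = wf-⊥
WF-close Δ p (φ ⇒ ψ) e cu (wf-⇒ w₁ w₂) = wf-⇒ (WF-close Δ p φ e cu w₁) (WF-close Δ p ψ e cu w₂)
WF-close Δ p (φ ∧' ψ) e cu (wf-∧ w₁ w₂) = wf-∧ (WF-close Δ p φ e cu w₁) (WF-close Δ p ψ e cu w₂)
WF-close Δ p (φ ∨' ψ) e cu (wf-∨ w₁ w₂) = wf-∨ (WF-close Δ p φ e cu w₁) (WF-close Δ p ψ e cu w₂)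
WF-close Δ p (∀' n φ) e cu (wf-∀ w) = wf-∀ (WF-close (n ∷ Δ) p φ e cu w)
WF-close Δ p (∃' n φ) e cu (wf-∃ w) = wf-∃ (WF-close (n ∷ Δ) p φ e cu w)

tyS-weaken : ∀ Δ Δ' t {r} → tyS Δ t ≡ just r → tyS (Δ ++ Δ') t ≡ just r
tyS-weaken Δ Δ' (fv n i) e = e
tyS-weaken Δ Δ' (bv k) e = lookupM-++ Δ Δ' k e
tyS-weaken Δ Δ' (up t) e with tyS Δ t in eq
tyS-weaken Δ Δ' (up t) refl | just r rewrite tyS-weaken Δ Δ' t eq = refl

WF-weaken : ∀ Δ Δ' φ → WF↑ Δ φ → WF↑ (Δ ++ Δ') φ
WF-weaken Δ Δ' (atom y x) (wf-atom e₁ e₂ ok) = wf-atom (tyS-weaken Δ Δ' y e₁) (tyS-weaken Δ Δ' x e₂) ok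
WF-weaken Δ Δ' (a ≐ b) (wf-eq e₁ e₂) = wf-eq (tyS-weaken Δ Δ' a e₁) (tyS-weaken Δ Δ' b e₂)
WF-weaken Δ Δ' ⊥' w = wf-⊥
WF-weaken Δ Δ' (φ ⇒ ψ) (wf-⇒ w₁ w₂) = wf-⇒ (WF-weaken Δ Δ' φ w₁) (WF-weaken Δ Δ' ψ w₂)
WF-weaken Δ Δ' (φ ∧' ψ) (wf-∧ w₁ w₂) = wf-∧ (WF-weaken Δ Δ' φ w₁) (WF-weaken Δ Δ' ψ w₂)
WF-weaken Δ Δ' (φ ∨' ψ) (wf-∨ w₁ w₂) = wf-∨ (WF-weaken Δ Δ' φ w₁) (WF-weaken Δ Δ' ψ w₂)
WF-weaken Δ Δ' (∀' n φ) (wf-∀ w) = wf-∀ (WF-weaken (n ∷ Δ) Δ' φ w)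
WF-weaken Δ Δ' (∃' n φ) (wf-∃ w) = wf-∃ (WF-weaken (n ∷ Δ) Δ' φ w)

openS-out-of-scope : ∀ Δ d u t {r} → length Δ ≤ d → tyS Δ t ≡ just r → openS d u t ≡ t
openS-out-of-scope Δ d u (fv n i) le e = refl
openS-out-of-scope Δ d u (bv k) le e = openS-bv-miss u (<⇒≢ (<-≤-trans (lookupM-bounded Δ k e) le))
openS-out-of-scope Δ d u (up t) le e with tyS Δ t in eq
openS-out-of-scope Δ d u (up t) le refl | just r = cong up (openS-out-of-scope Δ d u t le eq)

open↑-out-of-scope : ∀ Δ d u φ → length Δ ≤ d → WF↑ Δ φ → open↑ d u φ ≡ φ
open↑-out-of-scope Δ d u (atom y x) le (wf-atom e₁ e₂ ok) =
  cong₂ atom (openS-out-of-scope Δ d u y le e₁) (openS-out-of-scope Δ d u x le e₂)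
open↑-out-of-scope Δ d u (a ≐ b) le (wf-eq e₁ e₂) =
  cong₂ _≐_ (openS-out-of-scope Δ d u a le e₁) (openS-out-of-scope Δ d u b le e₂)
open↑-out-of-scope Δ d u ⊥' le w = refl
open↑-out-of-scope Δ d u (φ ⇒ ψ) le (wf-⇒ w₁ w₂) =
  cong₂ _⇒_ (open↑-out-of-scope Δ d u φ le w₁) (open↑-out-of-scope Δ d u ψ le w₂)
open↑-out-of-scope Δ d u (φ ∧' ψ) le (wf-∧ w₁ w₂) =
  cong₂ _∧'_ (open↑-out-of-scope Δ d u φ le w₁) (open↑-out-of-scope Δ d u ψ le w₂)
open↑-out-of-scope Δ d u (φ ∨' ψ) le (wf-∨ w₁ w₂) =
  cong₂ _∨'_ (open↑-out-of-scope Δ d u φ le w₁) (open↑-out-of-scope Δ d u ψ le w₂)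
open↑-out-of-scope Δ d u (∀' n φ) le (wf-∀ w) =
  cong (∀' n) (open↑-out-of-scope (n ∷ Δ) (suc d) u φ (s≤s le) w)
open↑-out-of-scope Δ d u (∃' n φ) le (wf-∃ w) =
  cong (∃' n) (open↑-out-of-scope (n ∷ Δ) (suc d) u φ (s≤s le) w)

varBoundT : TmS → ℕ
varBoundT (fv n i) = suc i
varBoundT (bv k) = 0
varBoundT (up t) = varBoundT t

varBound : Form TmS → ℕ
varBound (atom y x) = varBoundT y ⊔ varBoundT x
varBound (a ≐ b) = varBoundT a ⊔ varBoundT b
varBound ⊥' = 0
varBound (φ ⇒ ψ) = varBound φ ⊔ varBound ψ
varBound (φ ∧' ψ) = varBound φ ⊔ varBound ψ
varBound (φ ∨' ψ) = varBound φ ⊔ varBound ψ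
varBound (∀' n φ) = varBound φ
varBound (∃' n φ) = varBound φ

fresh : List (Form TmS) → ℕ
fresh [] = 0
fresh (φ ∷ Γ) = varBound φ ⊔ fresh Γ

varBoundT-fresh : ∀ n i t → varBoundT t ≤ i → ¬ OccS n i t
varBoundT-fresh n i (fv n' i') le (refl , refl) = 1+n≰n le
varBoundT-fresh n i (up t) le o = varBoundT-fresh n i t le o

varBound-fresh : ∀ n i φ → varBound φ ≤ i → ¬ OccF STT↑ n i φ
varBound-fresh n i (atom y x) le (inj₁ o) = varBoundT-fresh n i y (m⊔n≤o⇒m≤o _ _ le) o
varBound-fresh n i (atom y x) le (inj₂ o) = varBoundT-fresh n i x (m⊔n≤o⇒n≤o _ _ le) o
varBound-fresh n i (a ≐ b) le (inj₁ o) = varBoundT-fresh n i a (m⊔n≤o⇒m≤o _ _ le) o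
varBound-fresh n i (a ≐ b) le (inj₂ o) = varBoundT-fresh n i b (m⊔n≤o⇒n≤o _ _ le) o
varBound-fresh n i (φ ⇒ ψ) le (inj₁ o) = varBound-fresh n i φ (m⊔n≤o⇒m≤o _ _ le) o
varBound-fresh n i (φ ⇒ ψ) le (inj₂ o) = varBound-fresh n i ψ (m⊔n≤o⇒n≤o _ _ le) o
varBound-fresh n i (φ ∧' ψ) le (inj₁ o) = varBound-fresh n i φ (m⊔n≤o⇒m≤o _ _ le) o
varBound-fresh n i (φ ∧' ψ) le (inj₂ o) = varBound-fresh n i ψ (m⊔n≤o⇒n≤o _ _ le) o
varBound-fresh n i (φ ∨' ψ) le (inj₁ o) = varBound-fresh n i φ (m⊔n≤o⇒m≤o _ _ le) o
varBound-fresh n i (φ ∨' ψ) le (inj₂ o) = varBound-fresh n i ψ (m⊔n≤o⇒n≤o _ _ le) o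
varBound-fresh n i (∀' _ φ) le o = varBound-fresh n i φ le o
varBound-fresh n i (∃' _ φ) le o = varBound-fresh n i φ le o

fresh-FreshIn : ∀ n Γ → FreshIn STT↑ n (fresh Γ) Γ
fresh-FreshIn n Γ = go Γ ≤-refl
  where
  go : ∀ Θ → fresh Θ ≤ fresh Γ → FreshIn STT↑ n (fresh Γ) Θ
  go [] le = []
  go (φ ∷ Θ) le = varBound-fresh n _ φ (m⊔n≤o⇒m≤o _ _ le) ∷ go Θ (m⊔n≤o⇒n≤o _ _ le)

-- Derived rules of STT↑

infix 3 _≋_
_≋_ : Form TmS → Form TmS → Set
A ≋ B = ∀ Γ → Γ ⊢ (A ⇔ B)

⊢-cast : ∀ {Γ A B} → A ≡ B → Γ ⊢ A → Γ ⊢ B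
⊢-cast refl p = p

⊢-cast-hyp : ∀ {Γ A B C} → A ≡ B → (B ∷ Γ) ⊢ C → (A ∷ Γ) ⊢ C
⊢-cast-hyp refl p = p

assume : ∀ {Γ A} → WF↑₀ A → (A ∷ Γ) ⊢ A
assume w = hyp (here refl) w

assume₁ : ∀ {Γ A B} → WF↑₀ A → (B ∷ A ∷ Γ) ⊢ A
assume₁ w = hyp (there (here refl)) w

≋-to : ∀ {A B Γ} → A ≋ B → Γ ⊢ A → Γ ⊢ B
≋-to e p = ⇒E (∧E₁ (e _)) p

≋-from : ∀ {A B Γ} → A ≋ B → Γ ⊢ B → Γ ⊢ A
≋-from e p = ⇒E (∧E₂ (e _)) p

≋-refl : ∀ {A} → WF↑₀ A → A ≋ A
≋-refl w Γ = ∧I (⇒I w (assume w)) (⇒I w (assume w))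

≋-reflexive : ∀ {A B} → WF↑₀ A → A ≡ B → A ≋ B
≋-reflexive w refl = ≋-refl w

≋-sym : ∀ {A B} → A ≋ B → B ≋ A
≋-sym e Γ = ∧I (∧E₂ (e Γ)) (∧E₁ (e Γ))

≋-trans : ∀ {A B C} → WF↑₀ A → WF↑₀ C → A ≋ B → B ≋ C → A ≋ C
≋-trans wA wC e₁ e₂ Γ =
  ∧I (⇒I wA (≋-to e₂ (≋-to e₁ (assume wA)))) (⇒I wC (≋-from e₁ (≋-from e₂ (assume wC))))

theorems-≋ : ∀ {A B} → WF↑₀ A → WF↑₀ B → (∀ Γ → Γ ⊢ A) → (∀ Γ → Γ ⊢ B) → A ≋ B
theorems-≋ wA wB pA pB Γ = ∧I (⇒I wA (pB _)) (⇒I wB (pA _))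

⇒-cong : ∀ {A A' B B'} → WF↑₀ A → WF↑₀ A' → WF↑₀ B → WF↑₀ B' → A ≋ A' → B ≋ B' → (A ⇒ B) ≋ (A' ⇒ B')
⇒-cong wA wA' wB wB' eA eB Γ =
  ∧I (⇒I (wf-⇒ wA wB) (⇒I wA' (≋-to eB (⇒E (assume₁ (wf-⇒ wA wB)) (≋-from eA (assume wA'))))))
     (⇒I (wf-⇒ wA' wB') (⇒I wA (≋-from eB (⇒E (assume₁ (wf-⇒ wA' wB')) (≋-to eA (assume wA))))))

∧-cong : ∀ {A A' B B'} → WF↑₀ A → WF↑₀ A' → WF↑₀ B → WF↑₀ B' → A ≋ A' → B ≋ B' → (A ∧' B) ≋ (A' ∧' B')
∧-cong wA wA' wB wB' eA eB Γ =
  ∧I (⇒I (wf-∧ wA wB) (∧I (≋-to eA (∧E₁ (assume (wf-∧ wA wB)))) (≋-to eB (∧E₂ (assume (wf-∧ wA wB))))))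
     (⇒I (wf-∧ wA' wB') (∧I (≋-from eA (∧E₁ (assume (wf-∧ wA' wB'))))
                             (≋-from eB (∧E₂ (assume (wf-∧ wA' wB'))))))

∨-cong : ∀ {A A' B B'} → WF↑₀ A → WF↑₀ A' → WF↑₀ B → WF↑₀ B' → A ≋ A' → B ≋ B' → (A ∨' B) ≋ (A' ∨' B')
∨-cong wA wA' wB wB' eA eB Γ =
  ∧I (⇒I (wf-∨ wA wB) (∨E (assume (wf-∨ wA wB)) (∨I₁ wB' (≋-to eA (assume wA)))
                                               (∨I₂ wA' (≋-to eB (assume wB)))))
     (⇒I (wf-∨ wA' wB') (∨E (assume (wf-∨ wA' wB')) (∨I₁ wB (≋-from eA (assume wA')))
                                                   (∨I₂ wA (≋-from eB (assume wB')))))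

WF-∀⁻¹ : ∀ {Δ p A} → WF↑ Δ (∀' p A) → WF↑ (p ∷ Δ) A
WF-∀⁻¹ (wf-∀ w) = w

WF-∃⁻¹ : ∀ {Δ p A} → WF↑ Δ (∃' p A) → WF↑ (p ∷ Δ) A
WF-∃⁻¹ (wf-∃ w) = w

WF-⇒⁻¹ : ∀ {Δ A B} → WF↑ Δ (A ⇒ B) → WF↑ Δ A × WF↑ Δ B
WF-⇒⁻¹ (wf-⇒ v w) = v , w

WF-instance : ∀ {p u A} → tyS [] u ≡ just p → Closed u → WF↑ (p ∷ []) A → WF↑₀ (open↑ 0 u A)
WF-instance {p} {A = A} e cu = WF-open [] p A e cu

WF-instance-var : ∀ {p A} e → WF↑ (p ∷ []) A → WF↑₀ (open↑ 0 (fv p e) A)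
WF-instance-var e = WF-instance refl fv

∀-elim : ∀ {Γ p A u} → tyS [] u ≡ just p → Closed u → WF↑₀ (∀' p A) → Γ ⊢ ∀' p A → Γ ⊢ open↑ 0 u A
∀-elim e cu w P = ∀E _ e refl (WF-instance e cu (WF-∀⁻¹ w)) P

∀-intro-fresh : ∀ {Γ p A} → WF↑₀ (∀' p A) → (∀ e → Γ ⊢ open↑ 0 (fv p e) A) → Γ ⊢ ∀' p A
∀-intro-fresh {Γ} {p} {A} w h with fresh-FreshIn p (A ∷ Γ)
... | A-fresh ∷ Γ-fresh = ∀I _ refl Γ-fresh A-fresh w (h _)

∃-elim-fresh : ∀ {Γ p A C} → WF↑₀ (∃' p A) → WF↑₀ C → Γ ⊢ ∃' p A →
               (∀ e → (open↑ 0 (fv p e) A ∷ Γ) ⊢ C) → Γ ⊢ C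
∃-elim-fresh {Γ} {p} {A} {C} wA wC P h with fresh-FreshIn p (A ∷ C ∷ Γ)
... | A-fresh ∷ C-fresh ∷ Γ-fresh =
  ∃E _ refl Γ-fresh A-fresh C-fresh (WF-instance-var _ (WF-∃⁻¹ wA)) P (h _)

∀-cong : ∀ {p A B} → WF↑₀ (∀' p A) → WF↑₀ (∀' p B) →
         (∀ e → open↑ 0 (fv p e) A ≋ open↑ 0 (fv p e) B) → ∀' p A ≋ ∀' p B
∀-cong wA wB h Γ =
  ∧I (⇒I wA (∀-intro-fresh wB (λ e → ≋-to (h e) (∀-elim refl fv wA (assume wA)))))
     (⇒I wB (∀-intro-fresh wA (λ e → ≋-from (h e) (∀-elim refl fv wB (assume wB)))))

∃-cong : ∀ {p A B} → WF↑₀ (∃' p A) → WF↑₀ (∃' p B) →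
         (∀ e → open↑ 0 (fv p e) A ≋ open↑ 0 (fv p e) B) → ∃' p A ≋ ∃' p B
∃-cong {p} wA wB h Γ =
  ∧I (⇒I wA (∃-elim-fresh wA wB (assume wA) (λ e →
       ∃I (fv p e) refl refl wB (≋-to (h e) (assume (WF-instance-var e (WF-∃⁻¹ wA)))))))
     (⇒I wB (∃-elim-fresh wB wA (assume wB) (λ e →
       ∃I (fv p e) refl refl wA (≋-from (h e) (assume (WF-instance-var e (WF-∃⁻¹ wB)))))))

-- Consequences of the axioms of STT↑

AxSTT↑-WF : ∀ {φ} → AxSTT↑ φ → WF↑₀ φ
AxSTT↑-WF (comprehension n φ w) =
  wf-∃ (wf-∀ (wf-∧ (wf-⇒ z∋x (WF-weaken (n ∷ []) (suc n ∷ []) φ w))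
                   (wf-⇒ (WF-weaken (n ∷ []) (suc n ∷ []) φ w) z∋x)))
  where
  z∋x : WF↑ (n ∷ suc n ∷ []) (atom (bv 1) (bv 0))
  z∋x = wf-atom refl refl refl
AxSTT↑-WF (identity n) = wf-∀ (wf-∀ (wf-∧ (wf-⇒ eq leibniz) (wf-⇒ leibniz eq)))
  where
  eq = wf-eq refl refl
  leibniz = wf-∀ (wf-∧ (wf-⇒ (wf-atom refl refl refl) (wf-atom refl refl refl))
                       (wf-⇒ (wf-atom refl refl refl) (wf-atom refl refl refl)))
AxSTT↑-WF (upInject n) = wf-∀ (wf-∀ (wf-⇒ (wf-eq refl refl) (wf-eq refl refl)))
AxSTT↑-WF (upPossess n) =
  wf-∀ (wf-∀ (wf-∧ (wf-⇒ (wf-atom refl refl refl) (wf-atom refl refl refl))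
                   (wf-⇒ (wf-atom refl refl refl) (wf-atom refl refl refl))))
AxSTT↑-WF (upFounded n) = wf-∀ (wf-∀ (wf-⇒ (wf-atom refl refl refl) (wf-∃ (wf-eq refl refl))))
AxSTT↑-WF upBase = wf-∀ (wf-∀ (wf-⇒ (wf-atom refl refl refl) wf-⊥))

axiom-instance : ∀ {Γ p q A u v} → AxSTT↑ (∀' p (∀' q A)) →
                 tyS [] u ≡ just p → Closed u → tyS [] v ≡ just q → Closed v →
                 Γ ⊢ open↑ 0 v (open↑ 1 u A)
axiom-instance a eu cu ev cv =
  ∀-elim ev cv (WF-instance eu cu (WF-∀⁻¹ (AxSTT↑-WF a))) (∀-elim eu cu (AxSTT↑-WF a) (ax a (AxSTT↑-WF a)))

identity-leibniz : ∀ K {c d} → Closed c → Closed d → tyS [] c ≡ just K → tyS [] d ≡ just K →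
                   (c ≐ d) ≋ ∀' (suc K) (atom (bv 0) c ⇔ atom (bv 0) d)
identity-leibniz K {c} {d} cc cd ec ed Γ =
  ⊢-cast (cong₂ (λ s t → (s ≐ d) ⇔ ∀' (suc K) (atom (bv 0) t ⇔ atom (bv 0) d))
                      (openS-closed cc 0 d) (openS-closed cc 1 d))
        (axiom-instance (identity K) ec cc ed cd)

up-possess : ∀ n {a b} → Closed a → Closed b → tyS [] a ≡ just n → tyS [] b ≡ just (suc n) →
             atom (up b) (up a) ≋ atom b a
up-possess n {a} {b} ca cb ea eb Γ =
  subst (λ t → Γ ⊢ (atom (up b) (up t) ⇔ atom b t)) (openS-closed ca 0 b)
        (axiom-instance (upPossess n) ea ca eb cb)

ups-possess : ∀ k r {c t} → Closed c → Closed t → tyS [] c ≡ just (suc r) → tyS [] t ≡ just r →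
              atom (ups k c) (ups k t) ≋ atom c t
ups-possess zero r cc ct ec et = ≋-refl (wf-atom ec et refl)
ups-possess (suc k) r {c} {t} cc ct ec et =
  ≋-trans (wf-atom (cong (mapMaybe suc) tc) (cong (mapMaybe suc) tt) refl) (wf-atom ec et refl)
          (up-possess (k + r) (ups-closed k ct) (ups-closed k cc) tt tc)
          (ups-possess k r cc ct ec et)
  where
  tc : tyS [] (ups k c) ≡ just (suc (k + r))
  tc = trans (tyS-ups k [] c ec) (cong just (+-suc k r))
  tt = tyS-ups k [] t et

≐-subst : ∀ {Γ s t} (φ : Form TmS) {A B} → open↑ 0 s φ ≡ A → open↑ 0 t φ ≡ B → WF↑₀ B →
          Γ ⊢ (s ≐ t) → Γ ⊢ A → Γ ⊢ B
≐-subst φ refl refl w p q = =E φ w p q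

tyS-ups-var : ∀ k n i → tyS [] (ups k (fv n i)) ≡ just (k + n)
tyS-ups-var k n i = tyS-ups k [] (fv n i) refl

up-possess-≐ : ∀ r {Γ Y s t} → Closed Y → Closed t → tyS [] Y ≡ just (suc r) → tyS [] t ≡ just r →
               Γ ⊢ (s ≐ up t) → Γ ⊢ atom (up Y) s → Γ ⊢ atom Y t
up-possess-≐ r {Y = Y} {s} {t} cY ct eY et p q =
  ≋-to (up-possess r ct cY et eY)
    (≐-subst (atom (up Y) (bv 0)) (cong (λ Z → atom (up Z) s) (openS-closed cY 0 s))
                                  (cong (λ Z → atom (up Z) (up t)) (openS-closed cY 0 (up t)))
             (wf-atom (cong (mapMaybe suc) eY) (cong (mapMaybe suc) et) refl) p q)

leibniz-possess : ∀ K {Γ z u a} → Closed u → tyS [] u ≡ just (suc K) →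
                  Γ ⊢ ∀' (suc (suc K)) (atom (bv 0) (fv (suc K) z) ⇔ atom (bv 0) u) →
                  Γ ⊢ atom (fv (suc K) z) (fv K a) → Γ ⊢ atom u (fv K a)
leibniz-possess K cu eu z≡u z∋a =
  ≐-subst (atom (bv 0) (fv K _)) refl refl (wf-atom eu refl refl)
          (≋-from (identity-leibniz (suc K) fv cu refl eu) z≡u) z∋a

-- By Up-Founded, ↑^(j+2) a (b) forces b = ↑z, and Up-Possess turns it into ↑^(j+1) a (z), which
-- the induction hypothesis refutes.
ups-base : ∀ j α β {Γ} → Γ ⊢ ¬' atom (ups (suc j) (fv 0 α)) (fv j β)
ups-base zero α β = axiom-instance upBase refl fv refl fv
ups-base (suc j) α β {Γ} =
  ⇒I wf-↑Yb (∃-elim-fresh wf-∃b≐↑z wf-⊥ (⇒E founded (assume wf-↑Yb)) λ z →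
    ⇒E (ups-base j α z) (up-possess-≐ j cY fv tyY refl (assume (wf-eq refl refl)) (assume₁ wf-↑Yb)))
  where
  b = fv (suc j) β
  Y = ups (suc j) (fv 0 α)
  cY : Closed Y
  cY = ups-closed (suc j) fv
  tyY : tyS [] Y ≡ just (suc j)
  tyY = trans (tyS-ups-var (suc j) 0 α) (cong just (+-identityʳ (suc j)))
  wf-↑Yb : WF↑₀ (atom (up Y) b)
  wf-↑Yb = wf-atom (cong (mapMaybe suc) tyY) refl refl
  wf-∃b≐↑z : WF↑₀ (∃' j (b ≐ up (bv 0)))
  wf-∃b≐↑z = wf-∃ (wf-eq refl refl)
  founded : (atom (up Y) b ∷ Γ) ⊢ (atom (up Y) b ⇒ ∃' j (b ≐ up (bv 0)))
  founded = axiom-instance (upFounded j) refl fv tyY cY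

-- By Up-Founded and Up-Possess, ↑^(j+2) b (x) gives x = ↑z with ↑^(j+1) b (z); by induction
-- z = ↑^(j+1) w, so x = ↑^(j+2) w.
ups-founded : ∀ j n α β {Γ} →
  Γ ⊢ (atom (ups (suc j) (fv (suc n) β)) (fv (suc (j + n)) α)
       ⇒ ∃' n (fv (suc (j + n)) α ≐ ups (suc j) (bv 0)))
ups-founded zero n α β = axiom-instance (upFounded n) refl fv refl fv
ups-founded (suc j) n α β {Γ} =
  ⇒I wf-↑Yx (∃-elim-fresh wf-∃x≐↑z wf-goal (⇒E founded (assume wf-↑Yx)) λ z →
    ∃-elim-fresh wf-∃z≐↑w wf-goal
      (⇒E (ups-founded j n z β)
          (up-possess-≐ T cY fv tyY refl (assume (wf-eq refl refl)) (assume₁ wf-↑Yx))) λ w →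
      ∃I (fv n w) refl refl wf-goal
        (≐-subst (x ≐ up (bv 0)) refl refl (WF-instance-var w (WF-∃⁻¹ wf-goal))
                 (assume (WF-instance-var w (WF-∃⁻¹ wf-∃z≐↑w))) (assume₁ (wf-eq refl refl))))
  where
  T = suc (j + n)
  x = fv (suc T) α
  Y = ups (suc j) (fv (suc n) β)
  cY : Closed Y
  cY = ups-closed (suc j) fv
  tyY : tyS [] Y ≡ just (suc T)
  tyY = trans (tyS-ups-var (suc j) (suc n) β) (cong just (+-suc (suc j) n))
  wf-↑Yx : WF↑₀ (atom (up Y) x)
  wf-↑Yx = wf-atom (cong (mapMaybe suc) tyY) refl refl
  wf-∃x≐↑z : WF↑₀ (∃' T (x ≐ up (bv 0)))
  wf-∃x≐↑z = wf-∃ (wf-eq refl refl)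
  wf-∃z≐↑w : ∀ {z} → WF↑₀ (∃' n (fv T z ≐ ups (suc j) (bv 0)))
  wf-∃z≐↑w = wf-∃ (wf-eq refl (tyS-ups (suc j) (n ∷ []) (bv 0) refl))
  wf-goal : WF↑₀ (∃' n (x ≐ ups (suc (suc j)) (bv 0)))
  wf-goal = wf-∃ (wf-eq refl (tyS-ups (suc (suc j)) (n ∷ []) (bv 0) refl))
  founded : (atom (up Y) x ∷ Γ) ⊢ (atom (up Y) x ⇒ ∃' T (x ≐ up (bv 0)))
  founded = axiom-instance (upFounded T) refl fv tyY cY

leibniz-refl : ∀ p {Γ u} → Closed u → tyS [] u ≡ just p → Γ ⊢ ∀' (suc p) (atom (bv 0) u ⇔ atom (bv 0) u)
leibniz-refl p {u = u} cu tu =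
  ∀-intro-fresh (wf-∀ (wf-∧ (wf-⇒ z∋u z∋u) (wf-⇒ z∋u z∋u))) λ z →
    subst (λ t → _ ⊢ (atom (fv (suc p) z) t ⇔ atom (fv (suc p) z) t)) (sym (openS-closed cu 0 (fv (suc p) z)))
          (≋-refl (wf-atom refl tu refl) _)
  where
  z∋u : WF↑ (suc p ∷ []) (atom (bv 0) u)
  z∋u = wf-atom refl (trans (tyS-closed cu _) tu) refl

-- The translation

typeᵉ : (ℕ → ℕ) → TmC → ℕ
typeᵉ ρ (fv n i) = n
typeᵉ ρ (bv k) = ρ k

infixr 5 _∷ᵉ_
_∷ᵉ_ : ℕ → (ℕ → ℕ) → ℕ → ℕ
(n ∷ᵉ ρ) zero = n
(n ∷ᵉ ρ) (suc k) = ρ k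

update : (ℕ → ℕ) → ℕ → ℕ → ℕ → ℕ
update ρ d v k = if k ≡ᵇ d then v else ρ k

update-here : ∀ ρ d v → update ρ d v d ≡ v
update-here ρ d v rewrite ≡ᵇ-refl d = refl

-- I with the types of bound variables read off a function instead of a list (see I≡Iᵉ), so that
-- opening at depth d, which changes only the type of index d, is recorded by update.
Iᵉ : (ℕ → ℕ) → Form TmC → Form TmS
Iᵉ ρ (atom y x) = atom (trT y) (ups (typeᵉ ρ y ∸ 1 ∸ typeᵉ ρ x) (trT x))
Iᵉ ρ (a ≐ b)    = trT a ≐ trT b
Iᵉ ρ ⊥'         = ⊥'
Iᵉ ρ (φ ⇒ ψ)    = Iᵉ ρ φ ⇒ Iᵉ ρ ψ
Iᵉ ρ (φ ∧' ψ)   = Iᵉ ρ φ ∧' Iᵉ ρ ψ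
Iᵉ ρ (φ ∨' ψ)   = Iᵉ ρ φ ∨' Iᵉ ρ ψ
Iᵉ ρ (∀' n φ)   = ∀' n (Iᵉ (n ∷ᵉ ρ) φ)
Iᵉ ρ (∃' n φ)   = ∃' n (Iᵉ (n ∷ᵉ ρ) φ)

[_]ᵉ : ℕ → ℕ → ℕ
[ n ]ᵉ = update (const 0) 0 n

Iᵉ-ext : ∀ {ρ σ} φ → (∀ k → ρ k ≡ σ k) → Iᵉ ρ φ ≡ Iᵉ σ φ
Iᵉ-ext (atom y x) h = cong₂ (λ a b → atom (trT y) (ups (a ∸ 1 ∸ b) (trT x))) (type y) (type x)
  where
  type : ∀ t → typeᵉ _ t ≡ typeᵉ _ t
  type (fv n i) = refl
  type (bv k) = h k
Iᵉ-ext (a ≐ b) h = refl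
Iᵉ-ext ⊥' h = refl
Iᵉ-ext (φ ⇒ ψ) h = cong₂ _⇒_ (Iᵉ-ext φ h) (Iᵉ-ext ψ h)
Iᵉ-ext (φ ∧' ψ) h = cong₂ _∧'_ (Iᵉ-ext φ h) (Iᵉ-ext ψ h)
Iᵉ-ext (φ ∨' ψ) h = cong₂ _∨'_ (Iᵉ-ext φ h) (Iᵉ-ext ψ h)
Iᵉ-ext (∀' n φ) h = cong (∀' n) (Iᵉ-ext φ λ { zero → refl ; (suc k) → h k })
Iᵉ-ext (∃' n φ) h = cong (∃' n) (Iᵉ-ext φ λ { zero → refl ; (suc k) → h k })

I≡Iᵉ : ∀ Δ ρ φ → (∀ k → fromMaybe 0 (lookupM Δ k) ≡ ρ k) → I Δ φ ≡ Iᵉ ρ φ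
I≡Iᵉ Δ ρ (atom y x) h = cong₂ (λ a b → atom (trT y) (ups (a ∸ 1 ∸ b) (trT x))) (type y) (type x)
  where
  type : ∀ t → tyCD Δ t ≡ typeᵉ ρ t
  type (fv n i) = refl
  type (bv k) = h k
I≡Iᵉ Δ ρ (a ≐ b) h = refl
I≡Iᵉ Δ ρ ⊥' h = refl
I≡Iᵉ Δ ρ (φ ⇒ ψ) h = cong₂ _⇒_ (I≡Iᵉ Δ ρ φ h) (I≡Iᵉ Δ ρ ψ h)
I≡Iᵉ Δ ρ (φ ∧' ψ) h = cong₂ _∧'_ (I≡Iᵉ Δ ρ φ h) (I≡Iᵉ Δ ρ ψ h)
I≡Iᵉ Δ ρ (φ ∨' ψ) h = cong₂ _∨'_ (I≡Iᵉ Δ ρ φ h) (I≡Iᵉ Δ ρ ψ h)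
I≡Iᵉ Δ ρ (∀' n φ) h = cong (∀' n) (I≡Iᵉ (n ∷ Δ) (n ∷ᵉ ρ) φ λ { zero → refl ; (suc k) → h k })
I≡Iᵉ Δ ρ (∃' n φ) h = cong (∃' n) (I≡Iᵉ (n ∷ Δ) (n ∷ᵉ ρ) φ λ { zero → refl ; (suc k) → h k })

trT-open : ∀ j u t → trT (openC j u t) ≡ openS j (trT u) (trT t)
trT-open j u (fv n i) = refl
trT-open j u (bv k) with k ≡ᵇ j
... | true = refl
... | false = refl

typeᵉ-open : ∀ ρ j p l t → typeᵉ ρ (openC j (fv p l) t) ≡ typeᵉ (update ρ j p) t
typeᵉ-open ρ j p l (fv n i) = refl
typeᵉ-open ρ j p l (bv k) with k ≡ᵇ j
... | true = refl
... | false = refl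

∷ᵉ-update : ∀ n ρ j p k → (n ∷ᵉ update ρ j p) k ≡ update (n ∷ᵉ ρ) (suc j) p k
∷ᵉ-update n ρ j p zero = refl
∷ᵉ-update n ρ j p (suc k) = refl

Iᵉ-open : ∀ ρ j p l φ → open↑ j (fv p l) (Iᵉ (update ρ j p) φ) ≡ Iᵉ ρ (openᶜ j (fv p l) φ)
Iᵉ-open ρ j p l (atom y x) =
  cong₂ atom (sym (trT-open j (fv p l) y))
    (trans (openS-ups _ j (fv p l) (trT x))
      (sym (cong₂ ups (cong₂ (λ a b → a ∸ 1 ∸ b) (typeᵉ-open ρ j p l y) (typeᵉ-open ρ j p l x))
                      (trT-open j (fv p l) x))))
Iᵉ-open ρ j p l (a ≐ b) = cong₂ _≐_ (sym (trT-open j (fv p l) a)) (sym (trT-open j (fv p l) b))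
Iᵉ-open ρ j p l ⊥' = refl
Iᵉ-open ρ j p l (φ ⇒ ψ) = cong₂ _⇒_ (Iᵉ-open ρ j p l φ) (Iᵉ-open ρ j p l ψ)
Iᵉ-open ρ j p l (φ ∧' ψ) = cong₂ _∧'_ (Iᵉ-open ρ j p l φ) (Iᵉ-open ρ j p l ψ)
Iᵉ-open ρ j p l (φ ∨' ψ) = cong₂ _∨'_ (Iᵉ-open ρ j p l φ) (Iᵉ-open ρ j p l ψ)
Iᵉ-open ρ j p l (∀' n φ) = cong (∀' n) (trans (cong (open↑ (suc j) (fv p l)) (Iᵉ-ext φ (∷ᵉ-update n ρ j p)))
                                                 (Iᵉ-open (n ∷ᵉ ρ) (suc j) p l φ))
Iᵉ-open ρ j p l (∃' n φ) = cong (∃' n) (trans (cong (open↑ (suc j) (fv p l)) (Iᵉ-ext φ (∷ᵉ-update n ρ j p)))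
                                                 (Iᵉ-open (n ∷ᵉ ρ) (suc j) p l φ))

I-body : ∀ n φ → I (n ∷ []) φ ≡ Iᵉ [ n ]ᵉ φ
I-body n φ = I≡Iᵉ (n ∷ []) [ n ]ᵉ φ λ { zero → refl ; (suc k) → refl }

I-instance : ∀ n i φ → I [] (openᶜ 0 (fv n i) φ) ≡ open↑ 0 (fv n i) (Iᵉ [ n ]ᵉ φ)
I-instance n i φ = trans (I≡Iᵉ [] (const 0) _ λ _ → refl) (sym (Iᵉ-open (const 0) 0 n i φ))

trT-type : ∀ Δ t → tyS Δ (trT t) ≡ tyC Δ t
trT-type Δ (fv n i) = refl
trT-type Δ (bv k) = refl

tyCD-just : ∀ Δ t {r} → tyC Δ t ≡ just r → tyCD Δ t ≡ r
tyCD-just Δ t e rewrite e = refl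

I-WF : ∀ Δ φ → WF CTTω Δ φ → WF↑ Δ (I Δ φ)
I-WF Δ (atom y x) (wf-atom {n = n} {m = m} e₁ e₂ m<n) rewrite tyCD-just Δ y e₁ | tyCD-just Δ x e₂ =
  wf-atom (trans (trT-type Δ y) e₁) (tyS-ups (n ∸ 1 ∸ m) Δ (trT x) (trans (trT-type Δ x) e₂))
          (n≡suc[n∸1∸m+m] m<n)
  where
  n≡suc[n∸1∸m+m] : ∀ {n m} → m < n → n ≡ suc (n ∸ 1 ∸ m + m)
  n≡suc[n∸1∸m+m] (s≤s m≤n) = cong suc (sym (m∸n+n≡m m≤n))
I-WF Δ (a ≐ b) (wf-eq e₁ e₂) = wf-eq (trans (trT-type Δ a) e₁) (trans (trT-type Δ b) e₂)
I-WF Δ ⊥' w = wf-⊥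
I-WF Δ (φ ⇒ ψ) (wf-⇒ w₁ w₂) = wf-⇒ (I-WF Δ φ w₁) (I-WF Δ ψ w₂)
I-WF Δ (φ ∧' ψ) (wf-∧ w₁ w₂) = wf-∧ (I-WF Δ φ w₁) (I-WF Δ ψ w₂)
I-WF Δ (φ ∨' ψ) (wf-∨ w₁ w₂) = wf-∨ (I-WF Δ φ w₁) (I-WF Δ ψ w₂)
I-WF Δ (∀' n φ) (wf-∀ w) = wf-∀ (I-WF (n ∷ Δ) φ w)
I-WF Δ (∃' n φ) (wf-∃ w) = wf-∃ (I-WF (n ∷ Δ) φ w)

I-WF₀ : ∀ {φ} → WF₀ CTTω φ → WF↑₀ (I [] φ)
I-WF₀ = I-WF [] _

I-instance-WF : ∀ {n i φ} → WF₀ CTTω (openᶜ 0 (fv n i) φ) → WF↑₀ (open↑ 0 (fv n i) (Iᵉ [ n ]ᵉ φ))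
I-instance-WF {n} {i} {φ} w = subst WF↑₀ (I-instance n i φ) (I-WF₀ w)

occurs-ups : ∀ n i k t → OccS n i (ups k t) → OccS n i t
occurs-ups n i zero t o = o
occurs-ups n i (suc k) t o = occurs-ups n i k t o

occurs-trT : ∀ n i t → OccS n i (trT t) → OccC n i t
occurs-trT n i (fv n' i') o = o

occurs-I : ∀ n i Δ φ → OccF STT↑ n i (I Δ φ) → OccF CTTω n i φ
occurs-I n i Δ (atom y x) (inj₁ o) = inj₁ (occurs-trT n i y o)
occurs-I n i Δ (atom y x) (inj₂ o) =
  inj₂ (occurs-trT n i x (occurs-ups n i (tyCD Δ y ∸ 1 ∸ tyCD Δ x) (trT x) o))
occurs-I n i Δ (a ≐ b) (inj₁ o) = inj₁ (occurs-trT n i a o)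
occurs-I n i Δ (a ≐ b) (inj₂ o) = inj₂ (occurs-trT n i b o)
occurs-I n i Δ (φ ⇒ ψ) (inj₁ o) = inj₁ (occurs-I n i Δ φ o)
occurs-I n i Δ (φ ⇒ ψ) (inj₂ o) = inj₂ (occurs-I n i Δ ψ o)
occurs-I n i Δ (φ ∧' ψ) (inj₁ o) = inj₁ (occurs-I n i Δ φ o)
occurs-I n i Δ (φ ∧' ψ) (inj₂ o) = inj₂ (occurs-I n i Δ ψ o)
occurs-I n i Δ (φ ∨' ψ) (inj₁ o) = inj₁ (occurs-I n i Δ φ o)
occurs-I n i Δ (φ ∨' ψ) (inj₂ o) = inj₂ (occurs-I n i Δ ψ o)
occurs-I n i Δ (∀' m φ) o = occurs-I n i (m ∷ Δ) φ o
occurs-I n i Δ (∃' m φ) o = occurs-I n i (m ∷ Δ) φ o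

I-FreshIn : ∀ {n i} Γ → FreshIn CTTω n i Γ → FreshIn STT↑ n i (map (I []) Γ)
I-FreshIn [] [] = []
I-FreshIn (φ ∷ Γ) (f ∷ fs) = (f ∘ occurs-I _ _ [] φ) ∷ I-FreshIn Γ fs

-- Instantiating a translated body at a lifted term

sizeᶜ : Form TmC → ℕ
sizeᶜ (atom y x) = 1
sizeᶜ (a ≐ b) = 1
sizeᶜ ⊥' = 1
sizeᶜ (φ ⇒ ψ) = suc (sizeᶜ φ + sizeᶜ ψ)
sizeᶜ (φ ∧' ψ) = suc (sizeᶜ φ + sizeᶜ ψ)
sizeᶜ (φ ∨' ψ) = suc (sizeᶜ φ + sizeᶜ ψ)
sizeᶜ (∀' n φ) = suc (sizeᶜ φ)
sizeᶜ (∃' n φ) = suc (sizeᶜ φ)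

sizeᶜ-open : ∀ d u φ → sizeᶜ (openᶜ d u φ) ≡ sizeᶜ φ
sizeᶜ-open d u (atom y x) = refl
sizeᶜ-open d u (a ≐ b) = refl
sizeᶜ-open d u ⊥' = refl
sizeᶜ-open d u (φ ⇒ ψ) = cong₂ (λ a b → suc (a + b)) (sizeᶜ-open d u φ) (sizeᶜ-open d u ψ)
sizeᶜ-open d u (φ ∧' ψ) = cong₂ (λ a b → suc (a + b)) (sizeᶜ-open d u φ) (sizeᶜ-open d u ψ)
sizeᶜ-open d u (φ ∨' ψ) = cong₂ (λ a b → suc (a + b)) (sizeᶜ-open d u φ) (sizeᶜ-open d u ψ)
sizeᶜ-open d u (∀' n φ) = cong suc (sizeᶜ-open (suc d) u φ)
sizeᶜ-open d u (∃' n φ) = cong suc (sizeᶜ-open (suc d) u φ)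

data Opened (d : ℕ) : TmC → Set where
  free   : ∀ n i → Opened d (fv n i)
  opened : Opened d (bv d)

typed⇒Opened : ∀ d u t {r} → tyS [] (openS d u (trT t)) ≡ just r → Opened d t
typed⇒Opened d u (fv n i) e = free n i
typed⇒Opened d u (bv j) e with j ≟ d
... | yes refl = opened
... | no j≢d = case trans (cong (tyS []) (sym (openS-bv-miss u j≢d))) e of λ ()

typed-ups⇒typed : ∀ N t {r} → tyS [] (ups N t) ≡ just r → ∃[ r' ] tyS [] t ≡ just r'
typed-ups⇒typed zero t e = _ , e
typed-ups⇒typed (suc N) t e with tyS [] (ups N t) in eq
... | just _ = typed-ups⇒typed N t eq

atom-WF⁻¹ : ∀ {y x P Q} → WF↑₀ (atom y x) → tyS [] y ≡ just P → tyS [] x ≡ just Q → P ≡ suc Q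
atom-WF⁻¹ (wf-atom e₁ e₂ ok) f₁ f₂ with trans (sym e₁) f₁ | trans (sym e₂) f₂
... | refl | refl = ok

≐-WF⁻¹ : ∀ {s t P Q} → WF↑₀ (s ≐ t) → tyS [] s ≡ just P → tyS [] t ≡ just Q → P ≡ Q
≐-WF⁻¹ (wf-eq e₁ e₂) f₁ f₂ with trans (sym e₁) f₁ | trans (sym e₂) f₂
... | refl | refl = refl

a+[k+m]∸m≡a+k : ∀ a k m → a + (k + m) ∸ m ≡ a + k
a+[k+m]∸m≡a+k a k m = trans (cong (_∸ m) (sym (+-assoc a k m))) (m+n∸n≡m (a + k) m)

k+suc[b+q]∸1∸q≡k+b : ∀ k b q → k + suc (b + q) ∸ 1 ∸ q ≡ k + b
k+suc[b+q]∸1∸q≡k+b k b q = trans (cong (λ z → z ∸ 1 ∸ q) (+-suc k (b + q))) (a+[k+m]∸m≡a+k k b q)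

Iᵉ-inst : (ℕ → ℕ) → ℕ → ℕ → TmS → Form TmC → Form TmS
Iᵉ-inst ρ d m c ψ = open↑ d c (Iᵉ (update ρ d m) ψ)

openS-ups-update : ∀ (f : ℕ → ℕ) ρ d v u → openS d u (ups (f (update ρ d v d)) (bv d)) ≡ ups (f v) u
openS-ups-update f ρ d v u = trans (openS-ups-hit _ d u) (cong (λ z → ups (f z) u) (update-here ρ d v))

-- If the instantiated variable is the argument, ↑^(p-1-m) c and ↑^(p-1-(k+m)) (↑^k c) are the same
-- term; if it is the predicate, c(↑^b x) and ↑^k c(↑^(k+b) x) are equivalent by iterated Up-Possess.
lift-inst-atom : ∀ ρ d {m} k {c} → Closed c → tyS [] c ≡ just m → ∀ {y x} → Opened d y → Opened d x →
                 WF↑₀ (Iᵉ-inst ρ d m c (atom y x)) → WF↑₀ (Iᵉ-inst ρ d (k + m) (ups k c) (atom y x)) →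
                 Iᵉ-inst ρ d m c (atom y x) ≋ Iᵉ-inst ρ d (k + m) (ups k c) (atom y x)
lift-inst-atom ρ d k cc ec (free p j) (free q l) w₁ w₂ =
  ≋-reflexive w₁ (cong (atom (fv p j)) (trans (openS-closed xᶜ d _) (sym (openS-closed xᶜ d _))))
  where
  xᶜ = ups-closed (p ∸ 1 ∸ q) (fv {q} {l})
lift-inst-atom ρ d {m} k {c} cc ec (free p j) opened w₁ w₂ =
  subst₂ _≋_ (sym eq₁) (sym eq₂)
    (≋-reflexive (subst WF↑₀ eq₁ w₁)
      (cong (atom (fv p j)) (trans (cong (λ z → ups z c) p∸1∸m≡a+k) (sym (ups-+ a k c)))))
  where
  a = p ∸ 1 ∸ (k + m)
  eq₁ : Iᵉ-inst ρ d m c (atom (fv p j) (bv d)) ≡ atom (fv p j) (ups (p ∸ 1 ∸ m) c)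
  eq₁ = cong (atom (fv p j)) (openS-ups-update (λ z → p ∸ 1 ∸ z) ρ d m c)
  eq₂ : Iᵉ-inst ρ d (k + m) (ups k c) (atom (fv p j) (bv d)) ≡ atom (fv p j) (ups a (ups k c))
  eq₂ = cong (atom (fv p j)) (openS-ups-update (λ z → p ∸ 1 ∸ z) ρ d (k + m) (ups k c))
  p≡suc[a+[k+m]] : p ≡ suc (a + (k + m))
  p≡suc[a+[k+m]] = atom-WF⁻¹ (subst WF↑₀ eq₂ w₂) refl (tyS-ups a [] (ups k c) (tyS-ups k [] c ec))
  p∸1∸m≡a+k : p ∸ 1 ∸ m ≡ a + k
  p∸1∸m≡a+k = trans (cong (λ z → z ∸ 1 ∸ m) p≡suc[a+[k+m]]) (a+[k+m]∸m≡a+k a k m)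
lift-inst-atom ρ d {m} k {c} cc ec opened (free q l) w₁ w₂ =
  subst₂ _≋_ (sym eq₁) (sym eq₂)
    (≋-sym (subst (λ z → atom (ups k c) z ≋ atom c (ups b x))
                  (trans (ups-+ k b x) (cong (λ z → ups z x) (sym k+m∸1∸q≡k+b)))
                  (ups-possess k (b + q) cc (ups-closed b fv) (trans ec (cong just m≡suc[b+q]))
                               (tyS-ups b [] x refl))))
  where
  x : TmS
  x = fv q l
  b = m ∸ 1 ∸ q
  eq₁ : Iᵉ-inst ρ d m c (atom (bv d) (fv q l)) ≡ atom c (ups b x)
  eq₁ = cong₂ atom (openS-bv-hit d c)
          (trans (openS-closed (ups-closed _ fv) d c) (cong (λ z → ups (z ∸ 1 ∸ q) x) (update-here ρ d m)))
  eq₂ : Iᵉ-inst ρ d (k + m) (ups k c) (atom (bv d) (fv q l)) ≡ atom (ups k c) (ups (k + m ∸ 1 ∸ q) x)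
  eq₂ = cong₂ atom (openS-bv-hit d (ups k c))
          (trans (openS-closed (ups-closed _ fv) d (ups k c))
                 (cong (λ z → ups (z ∸ 1 ∸ q) x) (update-here ρ d (k + m))))
  m≡suc[b+q] : m ≡ suc (b + q)
  m≡suc[b+q] = atom-WF⁻¹ (subst WF↑₀ eq₁ w₁) ec (tyS-ups b [] x refl)
  k+m∸1∸q≡k+b : k + m ∸ 1 ∸ q ≡ k + b
  k+m∸1∸q≡k+b = trans (cong (λ z → k + z ∸ 1 ∸ q) m≡suc[b+q]) (k+suc[b+q]∸1∸q≡k+b k b q)
lift-inst-atom ρ d {m} k {c} cc ec opened opened w₁ w₂ =
  ⊥-elim (m≢1+n+m m (atom-WF⁻¹ (subst WF↑₀ eq₁ w₁) ec (tyS-ups (m ∸ 1 ∸ m) [] c ec)))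
  where
  eq₁ : Iᵉ-inst ρ d m c (atom (bv d) (bv d)) ≡ atom c (ups (m ∸ 1 ∸ m) c)
  eq₁ = cong₂ atom (openS-bv-hit d c) (openS-ups-update (λ z → z ∸ 1 ∸ z) ρ d m c)

tyS-open-hit : ∀ d {u r} → tyS [] u ≡ just r → tyS [] (openS d u (bv d)) ≡ just r
tyS-open-hit d {u} e = trans (cong (tyS []) (openS-bv-hit d u)) e

lift-inst-≐ : ∀ ρ d {m} k {c} → Closed c → tyS [] c ≡ just m → ∀ {a b} → Opened d a → Opened d b →
              WF↑₀ (Iᵉ-inst ρ d m c (a ≐ b)) → WF↑₀ (Iᵉ-inst ρ d (suc k + m) (ups (suc k) c) (a ≐ b)) →
              Iᵉ-inst ρ d m c (a ≐ b) ≋ Iᵉ-inst ρ d (suc k + m) (ups (suc k) c) (a ≐ b)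
lift-inst-≐ ρ d k cc ec (free p j) (free q l) w₁ w₂ = ≋-refl w₁
lift-inst-≐ ρ d k {c} cc ec opened opened w₁ w₂ =
  subst₂ _≋_ (sym (cong₂ _≐_ (openS-bv-hit d c) (openS-bv-hit d c)))
             (sym (cong₂ _≐_ (openS-bv-hit d (ups (suc k) c)) (openS-bv-hit d (ups (suc k) c))))
    (theorems-≋ (wf-eq ec ec) (wf-eq c'-type c'-type) (λ _ → =I c ec) (λ _ → =I (ups (suc k) c) c'-type))
  where
  c'-type = tyS-ups (suc k) [] c ec
lift-inst-≐ ρ d {m} k {c} cc ec opened (free q l) w₁ w₂ =
  ⊥-elim (m≢1+n+m m (trans (≐-WF⁻¹ w₁ (tyS-open-hit d ec) refl)
                           (sym (≐-WF⁻¹ w₂ (tyS-open-hit d (tyS-ups (suc k) [] c ec)) refl))))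
lift-inst-≐ ρ d {m} k {c} cc ec (free p j) opened w₁ w₂ =
  ⊥-elim (m≢1+n+m m (trans (sym (≐-WF⁻¹ w₁ refl (tyS-open-hit d ec)))
                           (≐-WF⁻¹ w₂ refl (tyS-open-hit d (tyS-ups (suc k) [] c ec)))))

Iᵉ-inst-under : ∀ p e ρ d v {u} → Closed u → ∀ χ →
  open↑ 0 (fv p e) (open↑ (suc d) u (Iᵉ (p ∷ᵉ update ρ d v) χ))
  ≡ Iᵉ-inst (p ∷ᵉ ρ) (suc d) v u (openᶜ 0 (fv p e) χ)
Iᵉ-inst-under p e ρ d v cu χ =
  trans (open↑-comm 0 (suc d) fv cu (λ ()) _)
        (cong (open↑ (suc d) _) (trans (cong (open↑ 0 (fv p e)) (Iᵉ-ext χ λ { zero → refl ; (suc k) → refl }))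
                                        (Iᵉ-open (update (p ∷ᵉ ρ) (suc d) v) 0 p e χ)))

-- The fuel f is needed because the quantifier case recurses on instances of the body.
lift-inst : ∀ f ψ → sizeᶜ ψ ≤ f → ∀ ρ d {m} k {c} → Closed c → tyS [] c ≡ just m →
            WF↑₀ (Iᵉ-inst ρ d m c ψ) → WF↑₀ (Iᵉ-inst ρ d (k + m) (ups k c) ψ) →
            Iᵉ-inst ρ d m c ψ ≋ Iᵉ-inst ρ d (k + m) (ups k c) ψ
lift-inst-under : ∀ f χ → sizeᶜ χ ≤ f → ∀ p ρ d {m} k {c} → Closed c → tyS [] c ≡ just m → ∀ e →
  WF↑₀ (open↑ 0 (fv p e) (open↑ (suc d) c (Iᵉ (p ∷ᵉ update ρ d m) χ))) →
  WF↑₀ (open↑ 0 (fv p e) (open↑ (suc d) (ups k c) (Iᵉ (p ∷ᵉ update ρ d (k + m)) χ))) →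
  open↑ 0 (fv p e) (open↑ (suc d) c (Iᵉ (p ∷ᵉ update ρ d m) χ)) ≋
  open↑ 0 (fv p e) (open↑ (suc d) (ups k c) (Iᵉ (p ∷ᵉ update ρ d (k + m)) χ))

lift-inst f ψ le ρ d zero cc ec w₁ w₂ = ≋-refl w₁
lift-inst f (atom y x) le ρ d {m} k@(suc _) {c} cc ec w₁@(wf-atom e₁ e₂ _) w₂ =
  lift-inst-atom ρ d k cc ec (typed⇒Opened d c y e₁) (typed⇒Opened d c x x-typed) w₁ w₂
  where
  N = typeᵉ (update ρ d m) y ∸ 1 ∸ typeᵉ (update ρ d m) x
  x-typed = proj₂ (typed-ups⇒typed N _ (trans (cong (tyS []) (sym (openS-ups N d c (trT x)))) e₂))
lift-inst f (a ≐ b) le ρ d (suc k) {c} cc ec w₁@(wf-eq e₁ e₂) w₂ =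
  lift-inst-≐ ρ d k cc ec (typed⇒Opened d c a e₁) (typed⇒Opened d c b e₂) w₁ w₂
lift-inst f ⊥' le ρ d (suc k) cc ec w₁ w₂ = ≋-refl wf-⊥
lift-inst (suc f) (φ ⇒ ψ) (s≤s le) ρ d k@(suc _) cc ec (wf-⇒ w₁ w₂) (wf-⇒ v₁ v₂) =
  ⇒-cong w₁ v₁ w₂ v₂ (lift-inst f φ (m+n≤o⇒m≤o _ le) ρ d k cc ec w₁ v₁)
                     (lift-inst f ψ (m+n≤o⇒n≤o _ le) ρ d k cc ec w₂ v₂)
lift-inst (suc f) (φ ∧' ψ) (s≤s le) ρ d k@(suc _) cc ec (wf-∧ w₁ w₂) (wf-∧ v₁ v₂) =
  ∧-cong w₁ v₁ w₂ v₂ (lift-inst f φ (m+n≤o⇒m≤o _ le) ρ d k cc ec w₁ v₁)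
                     (lift-inst f ψ (m+n≤o⇒n≤o _ le) ρ d k cc ec w₂ v₂)
lift-inst (suc f) (φ ∨' ψ) (s≤s le) ρ d k@(suc _) cc ec (wf-∨ w₁ w₂) (wf-∨ v₁ v₂) =
  ∨-cong w₁ v₁ w₂ v₂ (lift-inst f φ (m+n≤o⇒m≤o _ le) ρ d k cc ec w₁ v₁)
                     (lift-inst f ψ (m+n≤o⇒n≤o _ le) ρ d k cc ec w₂ v₂)
lift-inst (suc f) (∀' p χ) (s≤s le) ρ d k@(suc _) cc ec w₁ w₂ =
  ∀-cong w₁ w₂ λ e →
    lift-inst-under f χ le p ρ d k cc ec e (WF-instance-var e (WF-∀⁻¹ w₁)) (WF-instance-var e (WF-∀⁻¹ w₂))
lift-inst (suc f) (∃' p χ) (s≤s le) ρ d k@(suc _) cc ec w₁ w₂ =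
  ∃-cong w₁ w₂ λ e →
    lift-inst-under f χ le p ρ d k cc ec e (WF-instance-var e (WF-∃⁻¹ w₁)) (WF-instance-var e (WF-∃⁻¹ w₂))

lift-inst-under f χ le p ρ d {m} k {c} cc ec e w₁ w₂ =
  subst₂ _≋_ (sym (Iᵉ-inst-under p e ρ d m cc χ)) (sym (Iᵉ-inst-under p e ρ d (k + m) (ups-closed k cc) χ))
    (lift-inst f (openᶜ 0 (fv p e) χ) (subst (_≤ f) (sym (sizeᶜ-open 0 (fv p e) χ)) le)
               (p ∷ᵉ ρ) (suc d) k cc ec
      (subst WF↑₀ (Iᵉ-inst-under p e ρ d m cc χ) w₁)
      (subst WF↑₀ (Iᵉ-inst-under p e ρ d (k + m) (ups-closed k cc) χ) w₂))

-- The cumulative quantifier rules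

≤⇒lift : ∀ {m n} → m ≤ n → ∃[ k ] n ≡ k + m
≤⇒lift le = _ , sym (m∸n+n≡m le)

lift-inst₀ : ∀ φ m k i → WF↑₀ (open↑ 0 (fv m i) (Iᵉ [ m ]ᵉ φ)) → WF↑₀ (∀' (k + m) (Iᵉ [ k + m ]ᵉ φ)) →
             open↑ 0 (fv m i) (Iᵉ [ m ]ᵉ φ) ≋ open↑ 0 (ups k (fv m i)) (Iᵉ [ k + m ]ᵉ φ)
lift-inst₀ φ m k i w₁ w =
  lift-inst (sizeᶜ φ) φ ≤-refl (const 0) 0 k fv refl w₁
    (WF-instance (tyS-ups-var k m i) (ups-closed k fv) (WF-∀⁻¹ w))

∀-elim-lifted : ∀ {Γ} φ m k i → WF↑₀ (open↑ 0 (fv m i) (Iᵉ [ m ]ᵉ φ)) →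
                Γ ⊢ I [] (∀' (k + m) φ) → Γ ⊢ open↑ 0 (fv m i) (Iᵉ [ m ]ᵉ φ)
∀-elim-lifted {Γ} φ m k i w₁ P =
  ≋-from (lift-inst₀ φ m k i w₁ W) (∀-elim (tyS-ups-var k m i) (ups-closed k fv) W (⊢-cast ∀-body P))
  where
  ∀-body = cong (∀' (k + m)) (I-body (k + m) φ)
  W = subst WF↑₀ ∀-body (derivable⇒WF P)

cumulative-∀E : ∀ {Γ} φ {m n} i → m ≤ n → WF₀ CTTω (openᶜ 0 (fv m i) φ) →
                Γ ⊢ I [] (∀' n φ) → Γ ⊢ I [] (openᶜ 0 (fv m i) φ)
cumulative-∀E {Γ} φ {m} i le w P with ≤⇒lift le
... | k , refl = ⊢-cast (sym (I-instance m i φ)) (∀-elim-lifted φ m k i (I-instance-WF w) P)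

cumulative-∃I : ∀ {Γ} φ {m n} i → m ≤ n → WF₀ CTTω (∃' n φ) →
                Γ ⊢ I [] (openᶜ 0 (fv m i) φ) → Γ ⊢ I [] (∃' n φ)
cumulative-∃I {Γ} φ {m} i le w P with ≤⇒lift le
... | k , refl =
  ⊢-cast (sym ∃-body)
    (∃I (ups k (fv m i)) (tyS-ups-var k m i) refl W
      (≋-to (lift-inst₀ φ m k i w₁ (wf-∀ (WF-∃⁻¹ W))) (⊢-cast (I-instance m i φ) P)))
  where
  ∃-body = cong (∃' (k + m)) (I-body (k + m) φ)
  W = subst WF↑₀ ∃-body (I-WF₀ w)
  w₁ = subst WF↑₀ (I-instance m i φ) (derivable⇒WF P)

cumulative-∀-restrict : ∀ {Γ} φ {m n} → m ≤ n → WF₀ CTTω (∀' m φ) → Γ ⊢ I [] (∀' n φ) → Γ ⊢ I [] (∀' m φ)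
cumulative-∀-restrict {Γ} φ {m} le w P with ≤⇒lift le
... | k , refl =
  ⊢-cast (sym ∀-body) (∀-intro-fresh W λ e → ∀-elim-lifted φ m k e (WF-instance-var e (WF-∀⁻¹ W)) P)
  where
  ∀-body = cong (∀' m) (I-body m φ)
  W = subst WF↑₀ ∀-body (I-WF₀ w)

Iᵉ-body-fresh : ∀ {n b} φ → ¬ OccF CTTω n b φ → ¬ OccF STT↑ n b (Iᵉ [ n ]ᵉ φ)
Iᵉ-body-fresh {n} {b} φ b∉φ o = b∉φ (occurs-I n b (n ∷ []) φ (subst (OccF STT↑ n b) (sym (I-body n φ)) o))

generalize-instance : ∀ {Γ n b} φ → FreshIn CTTω n b Γ → ¬ OccF CTTω n b φ →
                      map (I []) Γ ⊢ I [] (openᶜ 0 (fv n b) φ) → map (I []) Γ ⊢ I [] (∀' n φ)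
generalize-instance {Γ} {n} {b} φ b∉Γ b∉φ P =
  ⊢-cast (sym ∀-body)
    (∀I b refl (I-FreshIn Γ b∉Γ) (Iᵉ-body-fresh φ b∉φ) (wf-∀ (WF-close [] n _ refl fv w))
        (⊢-cast (I-instance n b φ) P))
  where
  ∀-body = cong (∀' n) (I-body n φ)
  w = subst WF↑₀ (I-instance n b φ) (derivable⇒WF P)

cumulative-∀I : ∀ {Γ} φ {m n} b → m ≤ n → FreshIn CTTω n b Γ → ¬ OccF CTTω n b φ → WF₀ CTTω (∀' m φ) →
                map (I []) Γ ⊢ I [] (openᶜ 0 (fv n b) φ) → map (I []) Γ ⊢ I [] (∀' m φ)
cumulative-∀I φ b le b∉Γ b∉φ w P = cumulative-∀-restrict φ le w (generalize-instance φ b∉Γ b∉φ P)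

-- Stated as an implication so that the premises are hypotheses, which avoids weakening derivations
-- under the fresh witness.
∃-elim-lifted : ∀ {Γ} φ {C} m k → WF↑₀ (∃' m (Iᵉ [ m ]ᵉ φ)) → WF↑₀ (∀' (k + m) (Iᵉ [ k + m ]ᵉ φ ⇒ C)) →
                WF↑₀ C →
                Γ ⊢ ∃' m (Iᵉ [ m ]ᵉ φ) ⇒ (∀' (k + m) (Iᵉ [ k + m ]ᵉ φ ⇒ C) ⇒ C)
∃-elim-lifted {Γ} φ {C} m k WE WG wC =
  ⇒I WE (⇒I WG (∃-elim-fresh WE wC (assume₁ WE) λ e →
    ⇒E (subst (λ D → (_ ∷ _ ∷ _ ∷ Γ) ⊢ open↑ 0 (ups k (fv m e)) (Iᵉ [ k + m ]ᵉ φ) ⇒ D)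
              (open↑-out-of-scope [] 0 _ C z≤n wC)
           (∀-elim (tyS-ups-var k m e) (ups-closed k fv) WG (assume₁ WG)))
       (≋-to (lift-inst₀ φ m k e (w₁ e) (wf-∀ (proj₁ (WF-⇒⁻¹ (WF-∀⁻¹ WG))))) (assume (w₁ e)))))
  where
  w₁ = λ e → WF-instance-var e (WF-∃⁻¹ WE)

-- The minor premise is generalised to ∀x^n (φ(x) ⇒ ψ) and instantiated at ↑^(n-m) of the witness.
cumulative-∃E : ∀ {Γ} φ ψ {m n} b → m ≤ n → FreshIn CTTω n b Γ → ¬ OccF CTTω n b φ → ¬ OccF CTTω n b ψ →
                WF₀ CTTω (openᶜ 0 (fv n b) φ) → map (I []) Γ ⊢ I [] (∃' m φ) →
                (I [] (openᶜ 0 (fv n b) φ) ∷ map (I []) Γ) ⊢ I [] ψ →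
                map (I []) Γ ⊢ I [] ψ
cumulative-∃E {Γ} φ ψ {m} b le b∉Γ b∉φ b∉ψ w P Q with ≤⇒lift le
... | k , refl =
  ⇒E (⇒E (∃-elim-lifted φ m k WE WG wψ) (⊢-cast ∃-body P))
     (∀I b refl (I-FreshIn Γ b∉Γ) b∉body WG
       (subst (λ D → map (I []) Γ ⊢ open↑ 0 (fv n b) (Iᵉ [ n ]ᵉ φ) ⇒ D)
              (sym (open↑-out-of-scope [] 0 _ _ z≤n wψ))
         (⇒I wb (⊢-cast-hyp (sym (I-instance n b φ)) Q))))
  where
  n = k + m
  ∃-body = cong (∃' m) (I-body m φ)
  WE = subst WF↑₀ ∃-body (derivable⇒WF P)
  wψ = derivable⇒WF Q
  wb : WF↑₀ (open↑ 0 (fv n b) (Iᵉ [ n ]ᵉ φ))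
  wb = I-instance-WF w
  WG : WF↑₀ (∀' n (Iᵉ [ n ]ᵉ φ ⇒ I [] ψ))
  WG = wf-∀ (wf-⇒ (WF-close [] n _ refl fv wb) (WF-weaken [] (n ∷ []) _ wψ))
  b∉body : ¬ OccF STT↑ n b (Iᵉ [ n ]ᵉ φ ⇒ I [] ψ)
  b∉body (inj₁ o) = Iᵉ-body-fresh φ b∉φ o
  b∉body (inj₂ o) = b∉ψ (occurs-I n b [] ψ o)

-- The axioms of CTTω

typeBase↑ : ℕ → Form TmS
typeBase↑ m =
  ∀' 0 (∀' m (¬' ∃' (suc m) (∀' (suc (suc m)) (atom (bv 0) (bv 1) ⇔ atom (bv 0) (ups (suc m) (bv 3)))
                              ∧' atom (bv 0) (bv 1))))

I-typeBase : ∀ m → I [] (∀' 0 (∀' m (¬' memC m 0 (bv 0) (bv 1)))) ≡ typeBase↑ m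
I-typeBase m rewrite ⊔-identityʳ m | n∸n≡0 m = refl

typeBase↑-provable : ∀ m {Γ} → WF↑₀ (typeBase↑ m) → Γ ⊢ typeBase↑ m
typeBase↑-provable m {Γ} W =
  ∀-intro-fresh W λ x → ∀-intro-fresh (WF-instance-var x (WF-∀⁻¹ W)) λ y →
    ⊢-cast (sym (instance-shape x y))
      (⇒I (wf-∃z x y) (∃-elim-fresh (wf-∃z x y) wf-⊥ (assume (wf-∃z x y)) λ z →
        ⊢-cast-hyp (z-shape x y z)
          (⇒E (ups-base m x y)
            (leibniz-possess m (ups-closed (suc m) fv) (tyS-↑x x)
                             (∧E₁ (assume (wf-z x y z))) (∧E₂ (assume (wf-z x y z)))))))
  where
  ↑x : ℕ → TmS
  ↑x x = ups (suc m) (fv 0 x)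
  tyS-↑x : ∀ x → tyS [] (↑x x) ≡ just (suc m)
  tyS-↑x x = trans (tyS-ups-var (suc m) 0 x) (cong (λ k → just (suc k)) (+-identityʳ m))
  z≡↑x : TmS → ℕ → Form TmS
  z≡↑x z x = ∀' (suc (suc m)) (atom (bv 0) z ⇔ atom (bv 0) (↑x x))
  instance-shape : ∀ x y → open↑ 0 (fv m y) (open↑ 1 (fv 0 x)
                     (¬' ∃' (suc m) (∀' (suc (suc m)) (atom (bv 0) (bv 1) ⇔ atom (bv 0) (ups (suc m) (bv 3)))
                                     ∧' atom (bv 0) (bv 1))))
                   ≡ ¬' ∃' (suc m) (z≡↑x (bv 1) x ∧' atom (bv 0) (fv m y))
  instance-shape x y
    rewrite openS-ups m 3 (fv 0 x) (bv 3) | openS-closed (ups-closed m (fv {0} {x})) 2 (fv m y) = refl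
  z-shape : ∀ x y z → open↑ 0 (fv (suc m) z) (z≡↑x (bv 1) x ∧' atom (bv 0) (fv m y))
                      ≡ (z≡↑x (fv (suc m) z) x ∧' atom (fv (suc m) z) (fv m y))
  z-shape x y z rewrite openS-closed (ups-closed (suc m) (fv {0} {x})) 1 (fv (suc m) z) = refl
  wf-∃z : ∀ x y → WF↑₀ (∃' (suc m) (z≡↑x (bv 1) x ∧' atom (bv 0) (fv m y)))
  wf-∃z x y = proj₁ (WF-⇒⁻¹ (subst WF↑₀ (instance-shape x y)
                                      (WF-instance-var y (WF-∀⁻¹ (WF-instance-var x (WF-∀⁻¹ W))))))
  wf-z : ∀ x y z → WF↑₀ (z≡↑x (fv (suc m) z) x ∧' atom (fv (suc m) z) (fv m y))
  wf-z x y z = subst WF↑₀ (z-shape x y z) (WF-instance-var z (WF-∃⁻¹ (wf-∃z x y)))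

typeBase-translated : ∀ m {Γ} → let φ = ∀' 0 (∀' m (¬' memC m 0 (bv 0) (bv 1))) in
                      WF↑₀ (I [] φ) → Γ ⊢ I [] φ
typeBase-translated m W = ⊢-cast (sym (I-typeBase m)) (typeBase↑-provable m (subst WF↑₀ (I-typeBase m) W))

-- I of Type-Founded, with the exponents of ↑ as parameters: they are ⊔/∸-expressions in m and n
-- that only simplify once it is known whether m ≤ n or n < m.
typeFounded↑ : (m n K L J a₁ a₂ a₃ a₄ a₅ : ℕ) → Form TmS
typeFounded↑ m n K L J a₁ a₂ a₃ a₄ a₅ =
  ∀' m (∀' (suc n)
    (∃' K (∀' L (atom (bv 0) (ups a₁ (bv 1)) ⇔ atom (bv 0) (ups a₂ (bv 2))) ∧' atom (bv 0) (ups a₃ (bv 2)))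
     ⇒ ∃' n (∀' J (atom (bv 0) (ups a₄ (bv 3)) ⇔ atom (bv 0) (ups a₅ (bv 1))))))

typeFounded↑-below : ∀ m k K L a₁ a₂ a₃ {Γ} → WF↑₀ (typeFounded↑ m (k + m) K L (suc (k + m)) a₁ a₂ a₃ k 0) →
                     Γ ⊢ typeFounded↑ m (k + m) K L (suc (k + m)) a₁ a₂ a₃ k 0
typeFounded↑-below m k K L a₁ a₂ a₃ {Γ} W =
  ∀-intro-fresh W λ a → ∀-intro-fresh (WF-instance-var a (WF-∀⁻¹ W)) λ b →
    subst (λ C → Γ ⊢ open↑ 0 (fv (suc n) b) (open↑ 1 (fv m a) hypothesis) ⇒ C) (sym (conclusion-shape a b))
      (⇒I (proj₁ (WF-⇒⁻¹ (instance-WF a b)))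
        (∃I (↑a a) (tyS-ups-var k m a) refl (wf-conclusion a b)
          (⊢-cast (cong (λ t → ∀' (suc n) (atom (bv 0) t ⇔ atom (bv 0) (↑a a)))
                        (sym (openS-closed (ups-closed k fv) 1 (↑a a))))
            (leibniz-refl n (ups-closed k fv) (tyS-ups-var k m a)))))
  where
  n = k + m
  ↑a : ℕ → TmS
  ↑a a = ups k (fv m a)
  hypothesis conclusion : Form TmS
  hypothesis = ∃' K (∀' L (atom (bv 0) (ups a₁ (bv 1)) ⇔ atom (bv 0) (ups a₂ (bv 2)))
                    ∧' atom (bv 0) (ups a₃ (bv 2)))
  conclusion = ∃' n (∀' (suc n) (atom (bv 0) (ups k (bv 3)) ⇔ atom (bv 0) (bv 1)))
  instance-WF : ∀ a b → WF↑₀ (open↑ 0 (fv (suc n) b) (open↑ 1 (fv m a) (hypothesis ⇒ conclusion)))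
  instance-WF a b = WF-instance-var b (WF-∀⁻¹ (WF-instance-var a (WF-∀⁻¹ W)))
  conclusion-shape : ∀ a b → open↑ 0 (fv (suc n) b) (open↑ 1 (fv m a) conclusion)
                             ≡ ∃' n (∀' (suc n) (atom (bv 0) (↑a a) ⇔ atom (bv 0) (bv 1)))
  conclusion-shape a b
    rewrite openS-ups-hit k 3 (fv m a) | openS-closed (ups-closed k (fv {m} {a})) 2 (fv (suc n) b) = refl
  wf-conclusion : ∀ a b → WF↑₀ (∃' n (∀' (suc n) (atom (bv 0) (↑a a) ⇔ atom (bv 0) (bv 1))))
  wf-conclusion a b = subst WF↑₀ (conclusion-shape a b) (proj₂ (WF-⇒⁻¹ (instance-WF a b)))

typeFounded↑-above : ∀ n j {Γ} → let m = suc (j + n) in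
  WF↑₀ (typeFounded↑ m n (suc m) (suc (suc m)) (suc m) 0 (suc j) 0 0 (suc j)) →
  Γ ⊢ typeFounded↑ m n (suc m) (suc (suc m)) (suc m) 0 (suc j) 0 0 (suc j)
typeFounded↑-above n j {Γ} W =
  ∀-intro-fresh W λ a → ∀-intro-fresh (WF-instance-var a (WF-∀⁻¹ W)) λ b →
    ⊢-cast (sym (instance-shape a b))
      (⇒I (wf-premise a b) (∃-elim-fresh (wf-premise a b) (wf-conclusion a) (assume (wf-premise a b)) λ z →
        ⊢-cast-hyp (z-shape a b z)
          (∃-elim-fresh (wf-∃a≐↑w a) (wf-conclusion a)
            (⇒E (ups-founded j n a b)
              (leibniz-possess m (ups-closed (suc j) fv) (tyS-↑b b)
                               (∧E₁ (assume (wf-z a b z))) (∧E₂ (assume (wf-z a b z)))))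
            λ w → ∃I (fv n w) refl refl (wf-conclusion a)
              (⊢-cast (cong (λ t → ∀' (suc m) (atom (bv 0) (fv m a) ⇔ atom (bv 0) t))
                            (sym (openS-ups-hit (suc j) 1 (fv n w))))
                (≋-to (identity-leibniz m fv (ups-closed (suc j) fv) refl (tyS-ups-var (suc j) n w))
                  (⊢-cast (cong (fv m a ≐_) (openS-ups-hit (suc j) 0 (fv n w)))
                    (assume (WF-instance-var w (WF-∃⁻¹ (wf-∃a≐↑w a))))))))))
  where
  m = suc (j + n)
  ↑b : ℕ → TmS
  ↑b b = ups (suc j) (fv (suc n) b)
  tyS-↑b : ∀ b → tyS [] (↑b b) ≡ just (suc m)
  tyS-↑b b = trans (tyS-ups-var (suc j) (suc n) b) (cong just (+-suc (suc j) n))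
  z≡↑b : TmS → ℕ → Form TmS
  z≡↑b z b = ∀' (suc (suc m)) (atom (bv 0) z ⇔ atom (bv 0) (↑b b))
  premise : ℕ → ℕ → Form TmS
  premise a b = ∃' (suc m) (z≡↑b (bv 1) b ∧' atom (bv 0) (fv m a))
  conclusion : ℕ → Form TmS
  conclusion a = ∃' n (∀' (suc m) (atom (bv 0) (fv m a) ⇔ atom (bv 0) (ups (suc j) (bv 1))))
  instance-shape : ∀ a b →
    open↑ 0 (fv (suc n) b) (open↑ 1 (fv m a)
      (∃' (suc m) (∀' (suc (suc m)) (atom (bv 0) (bv 1) ⇔ atom (bv 0) (ups (suc j) (bv 2)))
                   ∧' atom (bv 0) (bv 2))
       ⇒ ∃' n (∀' (suc m) (atom (bv 0) (bv 3) ⇔ atom (bv 0) (ups (suc j) (bv 1))))))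
    ≡ (premise a b ⇒ conclusion a)
  instance-shape a b rewrite openS-ups j 3 (fv m a) (bv 2) | openS-ups j 2 (fv (suc n) b) (bv 2)
                           | openS-ups j 3 (fv m a) (bv 1) | openS-ups j 2 (fv (suc n) b) (bv 1) = refl
  instance-WF : ∀ a b → WF↑₀ (premise a b ⇒ conclusion a)
  instance-WF a b =
    subst WF↑₀ (instance-shape a b) (WF-instance-var b (WF-∀⁻¹ (WF-instance-var a (WF-∀⁻¹ W))))
  wf-premise : ∀ a b → WF↑₀ (premise a b)
  wf-premise a b = proj₁ (WF-⇒⁻¹ (instance-WF a b))
  wf-conclusion : ∀ a → WF↑₀ (conclusion a)
  wf-conclusion a = proj₂ (WF-⇒⁻¹ (instance-WF a 0))
  z-shape : ∀ a b z → open↑ 0 (fv (suc m) z) (z≡↑b (bv 1) b ∧' atom (bv 0) (fv m a))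
                      ≡ (z≡↑b (fv (suc m) z) b ∧' atom (fv (suc m) z) (fv m a))
  z-shape a b z rewrite openS-closed (ups-closed (suc j) (fv {suc n} {b})) 1 (fv (suc m) z) = refl
  wf-z : ∀ a b z → WF↑₀ (z≡↑b (fv (suc m) z) b ∧' atom (fv (suc m) z) (fv m a))
  wf-z a b z = subst WF↑₀ (z-shape a b z) (WF-instance-var z (WF-∃⁻¹ (wf-premise a b)))
  wf-∃a≐↑w : ∀ a → WF↑₀ (∃' n (fv m a ≐ ups (suc j) (bv 0)))
  wf-∃a≐↑w a = wf-∃ (wf-eq refl (tyS-ups (suc j) (n ∷ []) (bv 0) refl))

>⇒lift : ∀ {m n} → n < m → ∃[ j ] m ≡ suc (j + n)
>⇒lift {m} {n} n<m = m ∸ suc n , trans (sym (m∸n+n≡m n<m)) (+-suc _ n)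

typeFounded-translated : ∀ m n {Γ} →
  let φ = ∀' m (∀' (suc n) (memC m (suc n) (bv 1) (bv 0) ⇒ ∃' n (equivC m n (bv 2) (bv 0)))) in
  WF↑₀ (I [] φ) → Γ ⊢ I [] φ
typeFounded-translated m n with m ≤? n
... | yes m≤n with ≤⇒lift m≤n
...   | k , refl rewrite m≤n⇒m⊔n≡n (m≤n+m m k) | m+n∸n≡m k m | n∸n≡0 (k + m) =
  typeFounded↑-below m k _ _ _ _ _
typeFounded-translated m n | no m≰n with >⇒lift (≰⇒> m≰n)
...   | j , refl
  rewrite m≥n⇒m⊔n≡m (m≤n+m n j) | m≥n⇒m⊔n≡m (m≤n⇒m≤1+n (m≤n+m n j)) | n∸n≡0 (j + n) | m+n∸n≡m (suc j) n =
  typeFounded↑-above n j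

tyCD-++ : ∀ Δ Δ' t {r} → tyC Δ t ≡ just r → tyCD (Δ ++ Δ') t ≡ tyCD Δ t
tyCD-++ Δ Δ' (fv n i) e = refl
tyCD-++ Δ Δ' (bv k) e rewrite lookupM-++ Δ Δ' k e | e = refl

I-weaken : ∀ Δ Δ' φ → WF CTTω Δ φ → I (Δ ++ Δ') φ ≡ I Δ φ
I-weaken Δ Δ' (atom y x) (wf-atom e₁ e₂ _) =
  cong₂ (λ a b → atom (trT y) (ups (a ∸ 1 ∸ b) (trT x))) (tyCD-++ Δ Δ' y e₁) (tyCD-++ Δ Δ' x e₂)
I-weaken Δ Δ' (a ≐ b) w = refl
I-weaken Δ Δ' ⊥' w = refl
I-weaken Δ Δ' (φ ⇒ ψ) (wf-⇒ w₁ w₂) = cong₂ _⇒_ (I-weaken Δ Δ' φ w₁) (I-weaken Δ Δ' ψ w₂)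
I-weaken Δ Δ' (φ ∧' ψ) (wf-∧ w₁ w₂) = cong₂ _∧'_ (I-weaken Δ Δ' φ w₁) (I-weaken Δ Δ' ψ w₂)
I-weaken Δ Δ' (φ ∨' ψ) (wf-∨ w₁ w₂) = cong₂ _∨'_ (I-weaken Δ Δ' φ w₁) (I-weaken Δ Δ' ψ w₂)
I-weaken Δ Δ' (∀' n φ) (wf-∀ w) = cong (∀' n) (I-weaken (n ∷ Δ) Δ' φ w)
I-weaken Δ Δ' (∃' n φ) (wf-∃ w) = cong (∃' n) (I-weaken (n ∷ Δ) Δ' φ w)

comprehension-translated : ∀ n φ {Γ} → WF CTTω (n ∷ []) φ →
                           Γ ⊢ I [] (∃' (suc n) (∀' n (atom (bv 1) (bv 0) ⇔ φ)))
comprehension-translated n φ w =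
  ⊢-cast (cong₂ (λ t ψ → ∃' (suc n) (∀' n (atom (bv 1) (ups t (bv 0)) ⇔ ψ)))
                (sym (n∸n≡0 n)) (sym (I-weaken (n ∷ []) (suc n ∷ []) φ w)))
    (ax comprehension↑ (AxSTT↑-WF comprehension↑))
  where
  comprehension↑ = comprehension n (I (n ∷ []) φ) (I-WF (n ∷ []) φ w)

axiom-translated : ∀ {φ Γ} → AxCTT φ → WF₀ CTTω φ → Γ ⊢ I [] φ
axiom-translated (comprehension n φ w) _ = comprehension-translated n φ w
axiom-translated (typeFounded m n) w = typeFounded-translated m n (I-WF₀ w)
axiom-translated (typeBase m) w = typeBase-translated m (I-WF₀ w)

derivation-translated : ∀ {Γ φ} → Pf CTTω AxCTT Γ φ → map (I []) Γ ⊢ I [] φ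
derivation-translated (hyp φ∈Γ w) = hyp (∈-map⁺ (I []) φ∈Γ) (I-WF₀ w)
derivation-translated (ax a w) = axiom-translated a w
derivation-translated (⇒I w p) = ⇒I (I-WF₀ w) (derivation-translated p)
derivation-translated (⇒E p q) = ⇒E (derivation-translated p) (derivation-translated q)
derivation-translated (∧I p q) = ∧I (derivation-translated p) (derivation-translated q)
derivation-translated (∧E₁ p) = ∧E₁ (derivation-translated p)
derivation-translated (∧E₂ p) = ∧E₂ (derivation-translated p)
derivation-translated (∨I₁ w p) = ∨I₁ (I-WF₀ w) (derivation-translated p)
derivation-translated (∨I₂ w p) = ∨I₂ (I-WF₀ w) (derivation-translated p)
derivation-translated (∨E p q r) =
  ∨E (derivation-translated p) (derivation-translated q) (derivation-translated r)
derivation-translated (⊥E w p) = ⊥E (I-WF₀ w) (derivation-translated p)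
derivation-translated (raa w p) = raa (I-WF₀ w) (derivation-translated p)
derivation-translated (∀E {φ = φ} (fv _ i) refl m≤n w p) = cumulative-∀E φ i m≤n w (derivation-translated p)
derivation-translated (∀I {φ = φ} b m≤n b∉Γ b∉φ w p) =
  cumulative-∀I φ b m≤n b∉Γ b∉φ w (derivation-translated p)
derivation-translated (∃I {φ = φ} (fv _ i) refl m≤n w p) = cumulative-∃I φ i m≤n w (derivation-translated p)
derivation-translated (∃E {φ = φ} {ψ} b m≤n b∉Γ b∉φ b∉ψ w p q) =
  cumulative-∃E φ ψ b m≤n b∉Γ b∉φ b∉ψ w (derivation-translated p) (derivation-translated q)
derivation-translated (=I (fv n i) refl) = =I (fv n i) refl
derivation-translated (=E φ w p q) with derivable⇒WF p
derivation-translated (=E {fv n i} {fv .n j} φ w p q) | wf-eq refl refl =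
  ⊢-cast (sym (I-instance n j φ))
    (=E (Iᵉ [ n ]ᵉ φ) (I-instance-WF w) (derivation-translated p)
        (⊢-cast (I-instance n i φ) (derivation-translated q)))

lemmaC3 : (φ : Form TmC) → Thm CTTω AxCTT φ → Thm STT↑ AxSTT↑ (I [] φ)
lemmaC3 φ = derivation-translated
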